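{- Let $A=\begin{bmatrix}A' & a\end{bmatrix}$ and $B=\begin{bmatrix}b\\ B'\end{bmatrix}$ be strongly unimodular matrices, where $a$ is a column vector and $b$ is a row vector. Then the matrix $A\oplus_2 B=\begin{bmatrix}A' & ab\\ 0 & B'\end{bmatrix}$ is strongly unimodular.
   Context: A real matrix is totally unimodular (TU) if every square submatrix has determinant $0$, $+1$ or $-1$. A matrix $A$ is strongly unimodular (SU) if (i) $A$ is TU, and (ii) every matrix obtained from $A$ by setting a single $\pm 1$ entry to $0$ is also TU. Here $ab$ denotes the outer product of the column vector $a$ and the row vector $b$. -}

module Defs where

open import Data.Nat using (ℕ; zero; suc; _+_)
open import Data.Integer using (ℤ; 0ℤ; 1ℤ; -1ℤ; -_) renaming (_+_ to _+ℤ_; _*_ to _*ℤ_)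
open import Data.Fin using (Fin; zero; suc; punchIn; splitAt; toℕ; _≟_)
open import Data.Sum using (_⊎_; inj₁; inj₂)
open import Data.Bool using (_∧_; if_then_else_)
open import Relation.Nullary.Decidable using (⌊_⌋)
open import Relation.Binary.PropositionalEquality using (_≡_)
open import Function.Definitions using (Injective)

Matrix : ℕ → ℕ → Set
Matrix m n = Fin m → Fin n → ℤ

sumFin : ∀ n → (Fin n → ℤ) → ℤ
sumFin zero    f = 0ℤ
sumFin (suc n) f = f zero +ℤ sumFin n (λ i → f (suc i))

alt : ℕ → ℤ
alt zero    = 1ℤ
alt (suc k) = - alt k

det : ∀ {n} → Matrix n n → ℤ
det {zero}  M = 1ℤ
det {suc n} M = sumFin (suc n) λ j →
  alt (toℕ j) *ℤ (M zero j *ℤ det (λ r c → M (suc r) (punchIn j c)))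

submatrix : ∀ {m n k} → Matrix m n → (Fin k → Fin m) → (Fin k → Fin n) → Matrix k k
submatrix M r c i j = M (r i) (c j)

TU : ∀ {m n} → Matrix m n → Set
TU {m} {n} M = ∀ (k : ℕ) (r : Fin k → Fin m) (c : Fin k → Fin n) →
  Injective _≡_ _≡_ r → Injective _≡_ _≡_ c →
  (det (submatrix M r c) ≡ 0ℤ) ⊎ (det (submatrix M r c) ≡ 1ℤ) ⊎ (det (submatrix M r c) ≡ -1ℤ)

zeroEntry : ∀ {m n} → Matrix m n → Fin m → Fin n → Matrix m n
zeroEntry M i j r c = if ⌊ r ≟ i ⌋ ∧ ⌊ c ≟ j ⌋ then 0ℤ else M r c

SU : ∀ {m n} → Matrix m n → Set
SU {m} {n} M = TU M × (∀ (i : Fin m) (j : Fin n) →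
  (M i j ≡ 1ℤ ⊎ M i j ≡ -1ℤ) → TU (zeroEntry M i j))
  where open import Data.Product using (_×_)

appendCol : ∀ {m n} → Matrix m n → (Fin m → ℤ) → Matrix m (n + 1)
appendCol {n = n} A' a i j with splitAt n j
... | inj₁ j' = A' i j'
... | inj₂ _  = a i

prependRow : ∀ {p q} → (Fin q → ℤ) → Matrix p q → Matrix (1 + p) q
prependRow b B' zero    j = b j
prependRow b B' (suc i) j = B' i j

twoSum : ∀ {m n p q} → Matrix m n → (Fin m → ℤ) → (Fin q → ℤ) → Matrix p q →
  Matrix (m + p) (n + q)
twoSum {m} {n} A' a b B' i j with splitAt m i | splitAt n j
... | inj₁ i' | inj₁ j' = A' i' j'
... | inj₁ i' | inj₂ j' = a i' *ℤ b j'
... | inj₂ i' | inj₁ j' = 0ℤ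
... | inj₂ i' | inj₂ j' = B' i' j'

module Submission where

-- A square submatrix of the
-- 2-sum [A' ab ; 0 B'] picks rows and columns from the A- and B-parts in an
-- interleaved order, recorded by shuffles; it is a block matrix [X αβ ; 0 Y]
-- with interleaved rows and columns, whose determinant is 0, ± det X · det Y
-- or ± det [X | α] · det [β ; Y] according to the sizes of the parts
-- (det-block-*).  These factors are determinants of square submatrices of
-- [A' a] and [b ; B'], hence the 2-sum is TU (TwoSumTU).  Zeroing a ±1 entry
-- of A' or B' yields the 2-sum of matrices that are TU by strong unimodularity
-- (zero-in-A', zero-in-B').  Zeroing an entry a_i b_j of the corner block needs
-- a finer computation (ZeroInCorner): after splitting the first row, the
-- determinant is controlled using that [A' a] with a_i zeroed and [b ; B']
-- with b_j zeroed are TU (corner-combination).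

open import Data.Nat as ℕ using (ℕ; zero; suc; s≤s)
import Data.Nat.Properties as NP
open import Data.Integer using (ℤ; 0ℤ; 1ℤ; -1ℤ; -_; _+_; _*_; _-_; ∣_∣)
import Data.Integer as ℤ
open import Data.Integer.Properties hiding (_≟_)
open import Data.Integer.Tactic.RingSolver
open import Data.Fin using (Fin; zero; suc; punchIn; toℕ; splitAt; join; _↑ˡ_; _↑ʳ_; _≟_)
open import Data.Fin.Properties using (splitAt-↑ˡ; splitAt-↑ʳ; splitAt-join; splitAt⁻¹-↑ˡ; splitAt⁻¹-↑ʳ; suc-injective; punchIn-injective; punchInᵢ≢i; any?)
open import Data.Sum using (_⊎_; inj₁; inj₂; [_,_]) renaming (map to ⊎map)
open import Data.Sum.Properties using (inj₁-injective; inj₂-injective; [,]-map; [,]-∘; map-map)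
open import Data.Product using (_×_; _,_; proj₁; proj₂)
open import Data.Empty using (⊥; ⊥-elim)
open import Data.Vec.Functional using (_∷_)
open import Function using (id; _∘_; case_of_)
open import Function.Definitions using (Injective)
open import Relation.Binary.PropositionalEquality hiding ([_])
open import Relation.Binary.Definitions using (tri<; tri≈; tri>)
open import Relation.Nullary using (¬_; yes; no)
open import Defs

sum-cong : ∀ n {f g : Fin n → ℤ} → (∀ i → f i ≡ g i) → sumFin n f ≡ sumFin n g
sum-cong zero    e = refl
sum-cong (suc n) e = cong₂ _+_ (e zero) (sum-cong n (λ i → e (suc i)))

sum-+ : ∀ n (f g : Fin n → ℤ) → sumFin n (λ i → f i + g i) ≡ sumFin n f + sumFin n g
sum-+ zero    f g = refl
sum-+ (suc n) f g =
  trans (cong (f zero + g zero +_) (sum-+ n _ _))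
        (interchange (f zero) (g zero) (sumFin n (f ∘ suc)) (sumFin n (g ∘ suc)))
  where
  interchange : ∀ a b c d → a + b + (c + d) ≡ a + c + (b + d)
  interchange = solve-∀

sum-* : ∀ n (c : ℤ) (f : Fin n → ℤ) → sumFin n (λ i → c * f i) ≡ c * sumFin n f
sum-* zero    c f = sym (*-zeroʳ c)
sum-* (suc n) c f = trans (cong (c * f zero +_) (sum-* n c _)) (sym (*-distribˡ-+ c _ _))

sum-neg : ∀ n (f : Fin n → ℤ) → sumFin n (λ i → - f i) ≡ - sumFin n f
sum-neg zero    f = refl
sum-neg (suc n) f = trans (cong (- f zero +_) (sum-neg n _)) (sym (neg-distrib-+ (f zero) _))

sum-zero : ∀ n {f : Fin n → ℤ} → (∀ i → f i ≡ 0ℤ) → sumFin n f ≡ 0ℤ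
sum-zero zero    e = refl
sum-zero (suc n) e = cong₂ _+_ (e zero) (sum-zero n (λ i → e (suc i)))

sum-single : ∀ n {f : Fin n → ℤ} (y : Fin n) → (∀ i → i ≢ y → f i ≡ 0ℤ) → sumFin n f ≡ f y
sum-single (suc n) {f} zero    e =
  trans (cong (f zero +_) (sum-zero n (λ i → e (suc i) (λ ())))) (+-identityʳ _)
sum-single (suc n) {f} (suc y) e =
  trans (cong₂ _+_ (e zero (λ ())) (sum-single n y (λ i i≢y → e (suc i) (i≢y ∘ suc-injective))))
        (+-identityˡ _)

-- Reindexing a double sum over pairs (j , l), where l ranges over the
-- indices different from j (encoded through punchIn j), by exchanging the
-- roles of the two members of each pair.  `partner j l` is the position of j
-- among the indices different from `punchIn j l`.

partner : ∀ {n} → Fin (suc n) → Fin n → Fin n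
partner zero    zero    = zero
partner zero    (suc l) = zero
partner (suc j) zero    = j
partner (suc j) (suc l) = suc (partner j l)

punchIn-partner : ∀ {n} (j : Fin (suc n)) (l : Fin n) → punchIn (punchIn j l) (partner j l) ≡ j
punchIn-partner zero    zero    = refl
punchIn-partner zero    (suc l) = refl
punchIn-partner (suc j) zero    = refl
punchIn-partner (suc j) (suc l) = cong suc (punchIn-partner j l)

punchIn-punchIn : ∀ {n} (j : Fin (suc (suc n))) (l : Fin (suc n)) (c : Fin n) →
  punchIn j (punchIn l c) ≡ punchIn (punchIn j l) (punchIn (partner j l) c)
punchIn-punchIn zero    zero    c       = refl
punchIn-punchIn zero    (suc l) c       = refl
punchIn-punchIn (suc j) zero    c       = refl
punchIn-punchIn (suc j) (suc l) zero    = refl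
punchIn-punchIn (suc j) (suc l) (suc c) = cong suc (punchIn-punchIn j l c)

alt-partner : ∀ {n} (j : Fin (suc n)) (l : Fin n) →
  alt (toℕ j) * alt (toℕ l) ≡ - (alt (toℕ (punchIn j l)) * alt (toℕ (partner j l)))
alt-partner zero    zero    = refl
alt-partner zero    (suc l) = identity (alt (toℕ l))
  where identity : ∀ x → 1ℤ * (- x) ≡ - ((- (- x)) * 1ℤ)
        identity = solve-∀
alt-partner (suc j) zero    = identity (alt (toℕ j))
  where identity : ∀ x → (- x) * 1ℤ ≡ - (1ℤ * x)
        identity = solve-∀
alt-partner (suc j) (suc l) =
  trans (negate-both (alt (toℕ j)) (alt (toℕ l)))
        (trans (alt-partner j l) (cong -_ (sym (negate-both (alt (toℕ (punchIn j l))) (alt (toℕ (partner j l)))))))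
  where negate-both : ∀ x y → (- x) * (- y) ≡ x * y
        negate-both = solve-∀

sum-pairs : ∀ n (F : Fin (suc n) → Fin n → ℤ) →
  sumFin (suc n) (λ j → sumFin n (F j)) ≡
  sumFin (suc n) (λ j → sumFin n (λ l → F (punchIn j l) (partner j l)))
sum-pairs zero    F = refl
sum-pairs (suc n) F = begin
  F₀ + sumFin (suc n) (λ j → F (suc j) zero + sumFin n (λ l → F (suc j) (suc l)))
    ≡⟨ cong (F₀ +_) (sum-+ (suc n) (λ j → F (suc j) zero) (λ j → sumFin n (λ l → F (suc j) (suc l)))) ⟩
  F₀ + (G₀ + sumFin (suc n) (λ j → sumFin n (λ l → F (suc j) (suc l))))
    ≡⟨ cong (λ z → F₀ + (G₀ + z)) (sum-pairs n (λ j l → F (suc j) (suc l))) ⟩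
  F₀ + (G₀ + rest)
    ≡⟨ exchange F₀ G₀ rest ⟩
  G₀ + (F₀ + rest)
    ≡⟨ cong (G₀ +_) (sum-+ (suc n) (F zero) (λ j → sumFin n (λ l → F (suc (punchIn j l)) (suc (partner j l))))) ⟨
  G₀ + sumFin (suc n) (λ j → F zero j + sumFin n (λ l → F (suc (punchIn j l)) (suc (partner j l)))) ∎
  where
  open ≡-Reasoning
  F₀ G₀ rest : ℤ
  F₀   = sumFin (suc n) (F zero)
  G₀   = sumFin (suc n) (λ j → F (suc j) zero)
  rest = sumFin (suc n) (λ j → sumFin n (λ l → F (suc (punchIn j l)) (suc (partner j l))))
  exchange : ∀ a b c → a + (b + c) ≡ b + (a + c)
  exchange = solve-∀

-- Determinants: the Laplace expansion along the first row is the definition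
-- of det, so `det M ≡ sumFin _ (cofactorTerm M)` holds by refl.

minor : ∀ {n} → Matrix (suc n) (suc n) → Fin (suc n) → Matrix n n
minor M j r c = M (suc r) (punchIn j c)

cofactorTerm : ∀ {n} → Matrix (suc n) (suc n) → Fin (suc n) → ℤ
cofactorTerm M j = alt (toℕ j) * (M zero j * det (minor M j))

det-cong : ∀ {n} {M N : Matrix n n} → (∀ i j → M i j ≡ N i j) → det M ≡ det N
det-cong {zero}  e = refl
det-cong {suc n} e = sum-cong (suc n) λ j →
  cong₂ (λ x y → alt (toℕ j) * (x * y)) (e zero j) (det-cong (λ r c → e (suc r) (punchIn j c)))

cofactorTerm-zero : ∀ {n} (M : Matrix (suc n) (suc n)) j → M zero j ≡ 0ℤ → cofactorTerm M j ≡ 0ℤ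
cofactorTerm-zero M j e = begin
  alt (toℕ j) * (M zero j * det (minor M j)) ≡⟨ cong (λ z → alt (toℕ j) * (z * det (minor M j))) e ⟩
  alt (toℕ j) * (0ℤ * det (minor M j))       ≡⟨ cong (alt (toℕ j) *_) (*-zeroˡ (det (minor M j))) ⟩
  alt (toℕ j) * 0ℤ                           ≡⟨ *-zeroʳ (alt (toℕ j)) ⟩
  0ℤ                                         ∎
  where open ≡-Reasoning

alt²≡1 : ∀ k → alt k * alt k ≡ 1ℤ
alt²≡1 zero    = refl
alt²≡1 (suc k) = trans (negate-both (alt k)) (alt²≡1 k)
  where negate-both : ∀ x → (- x) * (- x) ≡ x * x
        negate-both = solve-∀

-- Expanding along both
-- rows writes det M as a sum over pairs of columns; `sum-pairs` matches the
-- terms of the two expansions, which differ exactly by the sign `alt-partner`.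

swapTop : ∀ {n} → Matrix (suc (suc n)) (suc (suc n)) → Matrix (suc (suc n)) (suc (suc n))
swapTop M zero          = M (suc zero)
swapTop M (suc zero)    = M zero
swapTop M (suc (suc i)) = M (suc (suc i))

module _ {n : ℕ} (M : Matrix (suc (suc n)) (suc (suc n))) where

  pairTerm : Fin (suc (suc n)) → Fin (suc n) → ℤ
  pairTerm j l = alt (toℕ j) * (M zero j * (alt (toℕ l) * (M (suc zero) (punchIn j l) *
    det (λ r c → M (suc (suc r)) (punchIn j (punchIn l c))))))

  det-expand₂ : det M ≡ sumFin (suc (suc n)) (λ j → sumFin (suc n) (pairTerm j))
  det-expand₂ = sum-cong (suc (suc n)) λ j →
    trans (cong (alt (toℕ j) *_) (sym (sum-* (suc n) (M zero j) (cofactorTerm (minor M j)))))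
          (sym (sum-* (suc n) (alt (toℕ j)) (λ l → M zero j * cofactorTerm (minor M j) l)))

det-swapTop : ∀ {n} (M : Matrix (suc (suc n)) (suc (suc n))) → det (swapTop M) ≡ - det M
det-swapTop {n} M = begin
  det (swapTop M)
    ≡⟨ det-expand₂ (swapTop M) ⟩
  sumFin (suc (suc n)) (λ j → sumFin (suc n) (pairTerm (swapTop M) j))
    ≡⟨ sum-pairs (suc n) (pairTerm (swapTop M)) ⟩
  sumFin (suc (suc n)) (λ j → sumFin (suc n) (λ l → pairTerm (swapTop M) (punchIn j l) (partner j l)))
    ≡⟨ sum-cong (suc (suc n)) (λ j → sum-cong (suc n) (swapped-term j)) ⟩
  sumFin (suc (suc n)) (λ j → sumFin (suc n) (λ l → - pairTerm M j l))
    ≡⟨ sum-cong (suc (suc n)) (λ j → sum-neg (suc n) (pairTerm M j)) ⟩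
  sumFin (suc (suc n)) (λ j → - sumFin (suc n) (pairTerm M j))
    ≡⟨ sum-neg (suc (suc n)) (λ j → sumFin (suc n) (pairTerm M j)) ⟩
  - sumFin (suc (suc n)) (λ j → sumFin (suc n) (pairTerm M j))
    ≡⟨ cong -_ (det-expand₂ M) ⟨
  - det M ∎
  where
  open ≡-Reasoning
  swapped-term : ∀ j l → pairTerm (swapTop M) (punchIn j l) (partner j l) ≡ - pairTerm M j l
  swapped-term j l =
    trans (cong₂ (λ w D → alt (toℕ (punchIn j l)) * (M (suc zero) (punchIn j l) * (alt (toℕ (partner j l)) * (M zero w * D))))
                 (punchIn-partner j l)
                 (det-cong (λ r c → cong (M (suc (suc r))) (sym (punchIn-punchIn j l c)))))
          (regroup (alt (toℕ (punchIn j l))) (alt (toℕ (partner j l))) (alt (toℕ j)) (alt (toℕ l))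
                   (M (suc zero) (punchIn j l)) (M zero j) (det (λ r c → M (suc (suc r)) (punchIn j (punchIn l c)))) (alt-partner j l))
    where
    regroup : ∀ a b c d x y z → c * d ≡ - (a * b) → a * (x * (b * (y * z))) ≡ - (c * (y * (d * (x * z))))
    regroup a b c d x y z e =
      trans (pull a b x y z) (trans (cong (λ w → - (w * (x * (y * z)))) (sym e)) (push c d x y z))
      where pull : ∀ a b x y z → a * (x * (b * (y * z))) ≡ - ((- (a * b)) * (x * (y * z)))
            pull = solve-∀
            push : ∀ c d x y z → - ((c * d) * (x * (y * z))) ≡ - (c * (y * (d * (x * z))))
            push = solve-∀

-- A matrix with two equal first rows has determinant zero (d = - d ⇒ d = 0).
self-neg⇒0 : ∀ (x : ℤ) → x ≡ - x → x ≡ 0ℤ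
self-neg⇒0 (ℤ.+ zero)    e = refl
self-neg⇒0 (ℤ.+ suc n)   ()
self-neg⇒0 ℤ.-[1+ n ]    ()

det-equalTopRows : ∀ {n} (M : Matrix (suc (suc n)) (suc (suc n))) →
  (∀ c → M zero c ≡ M (suc zero) c) → det M ≡ 0ℤ
det-equalTopRows M e = self-neg⇒0 (det M) (trans (sym (det-cong swap-fixes)) (det-swapTop M))
  where swap-fixes : ∀ i j → swapTop M i j ≡ M i j
        swap-fixes zero          j = sym (e j)
        swap-fixes (suc zero)    j = e j
        swap-fixes (suc (suc i)) j = refl

moveToTop : ∀ {n} {A : Set} → Fin (suc n) → (Fin (suc n) → A) → Fin (suc n) → A
moveToTop p M zero    = M p
moveToTop p M (suc i) = M (punchIn p i)

det-moveToTop : ∀ {n} (p : Fin (suc n)) (M : Matrix (suc n) (suc n)) →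
  det (moveToTop p M) ≡ alt (toℕ p) * det M
det-moveToTop zero M = trans (det-cong same) (sym (*-identityˡ _))
  where same : ∀ i j → moveToTop zero M i j ≡ M i j
        same zero    j = refl
        same (suc i) j = refl
det-moveToTop {suc n} (suc p) M = begin
  det (moveToTop (suc p) M)
    ≡⟨ det-cong as-swap ⟩
  det (swapTop M′)
    ≡⟨ det-swapTop M′ ⟩
  - sumFin (suc (suc n)) (cofactorTerm M′)
    ≡⟨ cong -_ (sum-cong (suc (suc n)) term) ⟩
  - sumFin (suc (suc n)) (λ j → alt (toℕ p) * cofactorTerm M j)
    ≡⟨ cong -_ (sum-* (suc (suc n)) (alt (toℕ p)) (cofactorTerm M)) ⟩
  - (alt (toℕ p) * det M)
    ≡⟨ neg-distribˡ-* (alt (toℕ p)) (det M) ⟩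
  alt (toℕ (suc p)) * det M ∎
  where
  open ≡-Reasoning
  -- M with row p+1 moved to position 1; one more swap brings it to the top.
  M′ : Matrix (suc (suc n)) (suc (suc n))
  M′ zero    = M zero
  M′ (suc i) = moveToTop p (λ r → M (suc r)) i
  as-swap : ∀ i j → moveToTop (suc p) M i j ≡ swapTop M′ i j
  as-swap zero          j = refl
  as-swap (suc zero)    j = refl
  as-swap (suc (suc i)) j = refl
  minor-moved : ∀ j r c → minor M′ j r c ≡ moveToTop p (minor M j) r c
  minor-moved j zero    c = refl
  minor-moved j (suc r) c = refl
  term : ∀ j → cofactorTerm M′ j ≡ alt (toℕ p) * cofactorTerm M j
  term j = trans (cong (λ w → alt (toℕ j) * (M zero j * w))
                       (trans (det-cong (minor-moved j)) (det-moveToTop p (minor M j))))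
                 (rotate (alt (toℕ j)) (M zero j) (alt (toℕ p)) (det (minor M j)))
    where rotate : ∀ a b c d → a * (b * (c * d)) ≡ c * (a * (b * d))
          rotate = solve-∀

det-linear : ∀ {n} (i : Fin n) (M N O : Matrix n n) →
  (∀ r → r ≢ i → ∀ c → M r c ≡ N r c) → (∀ r → r ≢ i → ∀ c → M r c ≡ O r c) →
  (∀ c → M i c ≡ N i c + O i c) → det M ≡ det N + det O
det-linear {suc n} zero M N O eN eO ei =
  trans (sum-cong (suc n) term) (sum-+ (suc n) (cofactorTerm N) (cofactorTerm O))
  where
  open ≡-Reasoning
  term : ∀ j → cofactorTerm M j ≡ cofactorTerm N j + cofactorTerm O j
  term j = begin
    alt (toℕ j) * (M zero j * det (minor M j))
      ≡⟨ cong₂ (λ x D → alt (toℕ j) * (x * D)) (ei j) (det-cong (λ r c → eN (suc r) (λ ()) (punchIn j c))) ⟩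
    alt (toℕ j) * ((N zero j + O zero j) * det (minor N j))
      ≡⟨ cong (alt (toℕ j) *_) (*-distribʳ-+ _ (N zero j) (O zero j)) ⟩
    alt (toℕ j) * (N zero j * det (minor N j) + O zero j * det (minor N j))
      ≡⟨ *-distribˡ-+ (alt (toℕ j)) _ _ ⟩
    cofactorTerm N j + alt (toℕ j) * (O zero j * det (minor N j))
      ≡⟨ cong (λ D → cofactorTerm N j + alt (toℕ j) * (O zero j * D))
              (det-cong (λ r c → trans (sym (eN (suc r) (λ ()) (punchIn j c))) (eO (suc r) (λ ()) (punchIn j c)))) ⟩
    cofactorTerm N j + cofactorTerm O j ∎
det-linear {suc n} (suc i) M N O eN eO ei =
  trans (sum-cong (suc n) term) (sum-+ (suc n) (cofactorTerm N) (cofactorTerm O))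
  where
  open ≡-Reasoning
  term : ∀ j → cofactorTerm M j ≡ cofactorTerm N j + cofactorTerm O j
  term j = begin
    alt (toℕ j) * (M zero j * det (minor M j))
      ≡⟨ cong (λ D → alt (toℕ j) * (M zero j * D))
              (det-linear i (minor M j) (minor N j) (minor O j)
                 (λ r r≢i c → eN (suc r) (r≢i ∘ suc-injective) (punchIn j c))
                 (λ r r≢i c → eO (suc r) (r≢i ∘ suc-injective) (punchIn j c))
                 (λ c → ei (punchIn j c))) ⟩
    alt (toℕ j) * (M zero j * (det (minor N j) + det (minor O j)))
      ≡⟨ cong (alt (toℕ j) *_) (*-distribˡ-+ (M zero j) _ _) ⟩
    alt (toℕ j) * (M zero j * det (minor N j) + M zero j * det (minor O j))
      ≡⟨ *-distribˡ-+ (alt (toℕ j)) _ _ ⟩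
    alt (toℕ j) * (M zero j * det (minor N j)) + alt (toℕ j) * (M zero j * det (minor O j))
      ≡⟨ cong₂ (λ x y → alt (toℕ j) * (x * det (minor N j)) + alt (toℕ j) * (y * det (minor O j)))
               (eN zero (λ ()) j) (eO zero (λ ()) j) ⟩
    cofactorTerm N j + cofactorTerm O j ∎

det-linearTop : ∀ {k} (M N O : Matrix (suc k) (suc k)) →
  (∀ x c → M (suc x) c ≡ N (suc x) c) → (∀ x c → M (suc x) c ≡ O (suc x) c) →
  (∀ c → M zero c ≡ N zero c + O zero c) → det M ≡ det N + det O
det-linearTop {k} M N O eN eO e₀ = det-linear zero M N O (below N eN) (below O eO) e₀
  where below : ∀ (N : Matrix (suc k) (suc k)) → (∀ x c → M (suc x) c ≡ N (suc x) c) → ∀ r → r ≢ zero → ∀ c → M r c ≡ N r c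
        below N e zero    r≢0 c = ⊥-elim (r≢0 refl)
        below N e (suc r) r≢0 c = e r c

det-scaleTop : ∀ {n} (M N : Matrix (suc n) (suc n)) c →
  (∀ j → M zero j ≡ c * N zero j) → (∀ i j → M (suc i) j ≡ N (suc i) j) → det M ≡ c * det N
det-scaleTop {n} M N c e0 e1 =
  trans (sum-cong (suc n) λ j →
           trans (cong₂ (λ x D → alt (toℕ j) * (x * D)) (e0 j) (det-cong (λ r c′ → e1 r (punchIn j c′))))
                 (rotate (alt (toℕ j)) c (N zero j) (det (minor N j))))
        (sum-* (suc n) c (cofactorTerm N))
  where rotate : ∀ a c x d → a * (c * x * d) ≡ c * (a * (x * d))
        rotate = solve-∀

det-singleTop : ∀ {n} (M : Matrix (suc n) (suc n)) y → (∀ j → j ≢ y → M zero j ≡ 0ℤ) → det M ≡ cofactorTerm M y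
det-singleTop {n} M y zeros = sum-single (suc n) y (λ j j≢y → cofactorTerm-zero M j (zeros j j≢y))

-- A square submatrix of the 2-sum takes some rows from the A-part
-- and some from the B-part, in an interleaved order; likewise for columns.
-- `Shuffle a b k` records such an interleaving of a left items and b right
-- items into k positions.  Its sign is (-1)^(number of pairs in which a right
-- item precedes a left item), the sign of the permutation that sorts it.

data Shuffle : ℕ → ℕ → ℕ → Set where
  done  : Shuffle 0 0 0
  left  : ∀ {a b k} → Shuffle a b k → Shuffle (suc a) b (suc k)
  right : ∀ {a b k} → Shuffle a b k → Shuffle a (suc b) (suc k)

side : ∀ {a b k} → Shuffle a b k → Fin k → Fin a ⊎ Fin b
side (left κ)  zero    = inj₁ zero
side (left κ)  (suc i) = ⊎map suc id (side κ i)
side (right κ) zero    = inj₂ zero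
side (right κ) (suc i) = ⊎map id suc (side κ i)

posˡ : ∀ {a b k} → Shuffle a b k → Fin a → Fin k
posˡ (left κ)  zero    = zero
posˡ (left κ)  (suc x) = suc (posˡ κ x)
posˡ (right κ) x       = suc (posˡ κ x)

posʳ : ∀ {a b k} → Shuffle a b k → Fin b → Fin k
posʳ (right κ) zero    = zero
posʳ (right κ) (suc y) = suc (posʳ κ y)
posʳ (left κ)  y       = suc (posʳ κ y)

shuffleSign : ∀ {a b k} → Shuffle a b k → ℤ
shuffleSign done          = 1ℤ
shuffleSign (left κ)      = shuffleSign κ
shuffleSign (right {a} κ) = alt a * shuffleSign κ

shuffle-size : ∀ {a b k} → Shuffle a b k → a ℕ.+ b ≡ k
shuffle-size done              = refl
shuffle-size (left κ)          = cong suc (shuffle-size κ)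
shuffle-size (right {a} {b} κ) = trans (NP.+-suc a b) (cong suc (shuffle-size κ))

side-posˡ : ∀ {a b k} (κ : Shuffle a b k) x → side κ (posˡ κ x) ≡ inj₁ x
side-posˡ (left κ)  zero    = refl
side-posˡ (left κ)  (suc x) = cong (⊎map suc id) (side-posˡ κ x)
side-posˡ (right κ) x       = cong (⊎map id suc) (side-posˡ κ x)

side-posʳ : ∀ {a b k} (κ : Shuffle a b k) y → side κ (posʳ κ y) ≡ inj₂ y
side-posʳ (right κ) zero    = refl
side-posʳ (right κ) (suc y) = cong (⊎map id suc) (side-posʳ κ y)
side-posʳ (left κ)  y       = cong (⊎map suc id) (side-posʳ κ y)

side-inverse : ∀ {a b k} (κ : Shuffle a b k) i → [ posˡ κ , posʳ κ ] (side κ i) ≡ i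
side-inverse (left κ)  zero    = refl
side-inverse (left κ)  (suc i) =
  trans ([,]-map (side κ i)) (trans (sym ([,]-∘ suc (side κ i))) (cong suc (side-inverse κ i)))
side-inverse (right κ) zero    = refl
side-inverse (right κ) (suc i) =
  trans ([,]-map (side κ i)) (trans (sym ([,]-∘ suc (side κ i))) (cong suc (side-inverse κ i)))

side-injective : ∀ {a b k} (κ : Shuffle a b k) → Injective _≡_ _≡_ (side κ)
side-injective κ {i} {j} e =
  trans (sym (side-inverse κ i)) (trans (cong [ posˡ κ , posʳ κ ] e) (side-inverse κ j))

sum-shuffle : ∀ {a b k} (κ : Shuffle a b k) (f : Fin k → ℤ) →
  sumFin k f ≡ sumFin a (f ∘ posˡ κ) + sumFin b (f ∘ posʳ κ)
sum-shuffle done      f = refl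
sum-shuffle (left κ)  f =
  trans (cong (f zero +_) (sum-shuffle κ (f ∘ suc))) (sym (+-assoc (f zero) _ _))
sum-shuffle (right κ) f =
  trans (cong (f zero +_) (sum-shuffle κ (f ∘ suc)))
        (exchange (f zero) (sumFin _ (f ∘ suc ∘ posˡ κ)) (sumFin _ (f ∘ suc ∘ posʳ κ)))
  where exchange : ∀ a b c → a + (b + c) ≡ b + (a + c)
        exchange = solve-∀

-- Removing one item from a shuffle.  (The nested patterns only serve to
-- expose that the remaining shuffle is nonempty.)

removeˡ : ∀ {a b k} → Shuffle (suc a) b (suc k) → Fin (suc a) → Shuffle a b k
removeˡ (left κ)            zero            = κ
removeˡ (left κ@(left _))   (suc x)         = left (removeˡ κ x)
removeˡ (left κ@(right _))  (suc x@zero)    = left (removeˡ κ x)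
removeˡ (left κ@(right _))  (suc x@(suc _)) = left (removeˡ κ x)
removeˡ (right κ@(left _))  x               = right (removeˡ κ x)
removeˡ (right κ@(right _)) x               = right (removeˡ κ x)

removeʳ : ∀ {a b k} → Shuffle a (suc b) (suc k) → Fin (suc b) → Shuffle a b k
removeʳ (right κ)           zero            = κ
removeʳ (right κ@(right _)) (suc y)         = right (removeʳ κ y)
removeʳ (right κ@(left _))  (suc y@zero)    = right (removeʳ κ y)
removeʳ (right κ@(left _))  (suc y@(suc _)) = right (removeʳ κ y)
removeʳ (left κ@(left _))   y               = left (removeʳ κ y)
removeʳ (left κ@(right _))  y               = left (removeʳ κ y)

⊎map-commute : ∀ {A B C D E F G H : Set} {f : C → E} {g : D → F} {h : A → C} {k : B → D}
  {f′ : G → E} {g′ : H → F} {h′ : A → G} {k′ : B → H} →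
  (∀ x → f (h x) ≡ f′ (h′ x)) → (∀ y → g (k y) ≡ g′ (k′ y)) →
  ∀ w → ⊎map f g (⊎map h k w) ≡ ⊎map f′ g′ (⊎map h′ k′ w)
⊎map-commute p q (inj₁ x) = cong inj₁ (p x)
⊎map-commute p q (inj₂ y) = cong inj₂ (q y)

side-removeˡ : ∀ {a b k} (κ : Shuffle (suc a) b (suc k)) x j →
  side κ (punchIn (posˡ κ x) j) ≡ ⊎map (punchIn x) id (side (removeˡ κ x) j)
side-removeˡ (left κ)            zero            j       = refl
side-removeˡ (left (left _))     (suc x)         zero    = refl
side-removeˡ (left (right _))    (suc zero)      zero    = refl
side-removeˡ (left (right _))    (suc (suc _))   zero    = refl
side-removeˡ (right (left _))    x               zero    = refl
side-removeˡ (right (right _))   x               zero    = refl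
side-removeˡ (left κ@(left _))   (suc x)         (suc j) =
  trans (cong (⊎map suc id) (side-removeˡ κ x j))
        (⊎map-commute (λ _ → refl) (λ _ → refl) (side (removeˡ κ x) j))
side-removeˡ (left κ@(right _))  (suc x@zero)    (suc j) =
  trans (cong (⊎map suc id) (side-removeˡ κ x j))
        (⊎map-commute (λ _ → refl) (λ _ → refl) (side (removeˡ κ x) j))
side-removeˡ (left κ@(right _))  (suc x@(suc _)) (suc j) =
  trans (cong (⊎map suc id) (side-removeˡ κ x j))
        (⊎map-commute (λ _ → refl) (λ _ → refl) (side (removeˡ κ x) j))
side-removeˡ (right κ@(left _))  x               (suc j) =
  trans (cong (⊎map id suc) (side-removeˡ κ x j))
        (⊎map-commute (λ _ → refl) (λ _ → refl) (side (removeˡ κ x) j))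
side-removeˡ (right κ@(right _)) x               (suc j) =
  trans (cong (⊎map id suc) (side-removeˡ κ x j))
        (⊎map-commute (λ _ → refl) (λ _ → refl) (side (removeˡ κ x) j))

side-removeʳ : ∀ {a b k} (κ : Shuffle a (suc b) (suc k)) y j →
  side κ (punchIn (posʳ κ y) j) ≡ ⊎map id (punchIn y) (side (removeʳ κ y) j)
side-removeʳ (right κ)           zero            j       = refl
side-removeʳ (right (right _))   (suc y)         zero    = refl
side-removeʳ (right (left _))    (suc zero)      zero    = refl
side-removeʳ (right (left _))    (suc (suc _))   zero    = refl
side-removeʳ (left (left _))     y               zero    = refl
side-removeʳ (left (right _))    y               zero    = refl
side-removeʳ (right κ@(right _)) (suc y)         (suc j) =
  trans (cong (⊎map id suc) (side-removeʳ κ y j))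
        (⊎map-commute (λ _ → refl) (λ _ → refl) (side (removeʳ κ y) j))
side-removeʳ (right κ@(left _))  (suc y@zero)    (suc j) =
  trans (cong (⊎map id suc) (side-removeʳ κ y j))
        (⊎map-commute (λ _ → refl) (λ _ → refl) (side (removeʳ κ y) j))
side-removeʳ (right κ@(left _))  (suc y@(suc _)) (suc j) =
  trans (cong (⊎map id suc) (side-removeʳ κ y j))
        (⊎map-commute (λ _ → refl) (λ _ → refl) (side (removeʳ κ y) j))
side-removeʳ (left κ@(left _))   y               (suc j) =
  trans (cong (⊎map suc id) (side-removeʳ κ y j))
        (⊎map-commute (λ _ → refl) (λ _ → refl) (side (removeʳ κ y) j))
side-removeʳ (left κ@(right _))  y               (suc j) =
  trans (cong (⊎map suc id) (side-removeʳ κ y j))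
        (⊎map-commute (λ _ → refl) (λ _ → refl) (side (removeʳ κ y) j))

-- Sign bookkeeping for one recursive step of sign-removeˡ / sign-removeʳ:
-- the position of the removed item moves by one, and the item passed over is
-- either left (shifting its index) or right (contributing a factor alt a).
passLeft : ∀ (p s S x : ℤ) → p * s ≡ S * x → (- p) * s ≡ S * (- x)
passLeft p s S x h = trans (sym (neg-distribˡ-* p s)) (trans (cong -_ h) (neg-distribʳ-* S x))

passRight : ∀ (p s S x e : ℤ) → p * s ≡ S * x → (- p) * (e * s) ≡ ((- e) * S) * x
passRight p s S x e h = trans (pull p s e) (trans (cong (λ w → - (e * w)) h) (push S x e))
  where pull : ∀ p s e → (- p) * (e * s) ≡ - (e * (p * s))
        pull = solve-∀
        push : ∀ S x e → - (e * (S * x)) ≡ ((- e) * S) * x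
        push = solve-∀

removeFront : ∀ s e → e * e ≡ 1ℤ → 1ℤ * s ≡ (e * s) * (e * 1ℤ)
removeFront s e h = trans (cong (_* s) (sym h)) (regroup s e)
  where regroup : ∀ s e → (e * e) * s ≡ (e * s) * (e * 1ℤ)
        regroup = solve-∀

passRightʳ : ∀ (p s S y e : ℤ) → p * s ≡ S * (e * y) → (- p) * (e * s) ≡ (e * S) * (e * (- y))
passRightʳ p s S y e h = trans (pull p s e) (trans (cong (λ w → - (e * w)) h) (push S e y))
  where pull : ∀ p s e → (- p) * (e * s) ≡ - (e * (p * s))
        pull = solve-∀
        push : ∀ S e y → - (e * (S * (e * y))) ≡ (e * S) * (e * (- y))
        push = solve-∀

passLeftʳ : ∀ (p s S e y : ℤ) → p * s ≡ S * (e * y) → (- p) * s ≡ S * ((- e) * y)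
passLeftʳ p s S e y h = trans (sym (neg-distribˡ-* p s)) (trans (cong -_ h) (push S e y))
  where push : ∀ S e y → - (S * (e * y)) ≡ S * ((- e) * y)
        push = solve-∀

-- Each recursive step passes
-- one item in front of the removed one.
sign-removeˡ : ∀ {a b k} (κ : Shuffle (suc a) b (suc k)) x →
  alt (toℕ (posˡ κ x)) * shuffleSign (removeˡ κ x) ≡ shuffleSign κ * alt (toℕ x)
sign-removeˡ (left κ) zero = *-comm 1ℤ (shuffleSign κ)
sign-removeˡ (left κ@(left _)) (suc x) =
  passLeft (alt (toℕ (posˡ κ x))) (shuffleSign (removeˡ κ x)) (shuffleSign κ) (alt (toℕ x)) (sign-removeˡ κ x)
sign-removeˡ (left κ@(right _)) (suc x@zero) =
  passLeft (alt (toℕ (posˡ κ x))) (shuffleSign (removeˡ κ x)) (shuffleSign κ) (alt (toℕ x)) (sign-removeˡ κ x)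
sign-removeˡ (left κ@(right _)) (suc x@(suc _)) =
  passLeft (alt (toℕ (posˡ κ x))) (shuffleSign (removeˡ κ x)) (shuffleSign κ) (alt (toℕ x)) (sign-removeˡ κ x)
sign-removeˡ {a} (right κ@(left _)) x =
  passRight (alt (toℕ (posˡ κ x))) (shuffleSign (removeˡ κ x)) (shuffleSign κ) (alt (toℕ x)) (alt a) (sign-removeˡ κ x)
sign-removeˡ {a} (right κ@(right _)) x =
  passRight (alt (toℕ (posˡ κ x))) (shuffleSign (removeˡ κ x)) (shuffleSign κ) (alt (toℕ x)) (alt a) (sign-removeˡ κ x)

sign-removeʳ : ∀ {a b k} (κ : Shuffle a (suc b) (suc k)) y →
  alt (toℕ (posʳ κ y)) * shuffleSign (removeʳ κ y) ≡ shuffleSign κ * (alt a * alt (toℕ y))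
sign-removeʳ {a} (right κ) zero = removeFront (shuffleSign κ) (alt a) (alt²≡1 a)
sign-removeʳ {a} (right κ@(right _)) (suc y) =
  passRightʳ (alt (toℕ (posʳ κ y))) (shuffleSign (removeʳ κ y)) (shuffleSign κ) (alt (toℕ y)) (alt a) (sign-removeʳ κ y)
sign-removeʳ {a} (right κ@(left _)) (suc y@zero) =
  passRightʳ (alt (toℕ (posʳ κ y))) (shuffleSign (removeʳ κ y)) (shuffleSign κ) (alt (toℕ y)) (alt a) (sign-removeʳ κ y)
sign-removeʳ {a} (right κ@(left _)) (suc y@(suc _)) =
  passRightʳ (alt (toℕ (posʳ κ y))) (shuffleSign (removeʳ κ y)) (shuffleSign κ) (alt (toℕ y)) (alt a) (sign-removeʳ κ y)
sign-removeʳ {suc a} (left κ@(left _)) y =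
  passLeftʳ (alt (toℕ (posʳ κ y))) (shuffleSign (removeʳ κ y)) (shuffleSign κ) (alt a) (alt (toℕ y)) (sign-removeʳ κ y)
sign-removeʳ {suc a} (left κ@(right _)) y =
  passLeftʳ (alt (toℕ (posʳ κ y))) (shuffleSign (removeʳ κ y)) (shuffleSign κ) (alt a) (alt (toℕ y)) (sign-removeʳ κ y)

sign²≡1 : ∀ {a b k} (κ : Shuffle a b k) → shuffleSign κ * shuffleSign κ ≡ 1ℤ
sign²≡1 done          = refl
sign²≡1 (left κ)      = sign²≡1 κ
sign²≡1 (right {a} κ) = trans (regroup (alt a) (shuffleSign κ)) (cong₂ _*_ (alt²≡1 a) (sign²≡1 κ))
  where regroup : ∀ x y → (x * y) * (x * y) ≡ (x * x) * (y * y)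
        regroup = solve-∀

side-noRight : ∀ {t} (κ : Shuffle t 0 t) j → side κ j ≡ inj₁ j
side-noRight (left κ) zero    = refl
side-noRight (left κ) (suc j) = cong (⊎map suc id) (side-noRight κ j)

sign-noRight : ∀ {t} (κ : Shuffle t 0 t) → shuffleSign κ ≡ 1ℤ
sign-noRight done     = refl
sign-noRight (left κ) = sign-noRight κ

lastRight : ∀ t → Shuffle t 1 (suc t)
lastRight zero    = right done
lastRight (suc t) = left (lastRight t)

-- Block matrices.  `block ρ κ X α β Y` is the k × k matrix
--     [ X   α β ]        (s + u rows, t + v columns)
--     [ 0   Y   ]
-- with its rows interleaved according to ρ and its columns according to κ.
-- Every square submatrix of a 2-sum has this shape.  Its determinant is
-- computed below by Laplace expansion along the first row, which is a row of
-- the top part (ρ = left _) or of the bottom part (ρ = right _):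
--   s < t      : det = 0                                 (det-block-short)
--   s = t      : det = ± det X · det Y                   (det-block-square)
--   s = t + 1  : det = ± det [X | α] · det [β ; Y]       (det-block-border)
--   s ≥ t + 2  : det = 0                                 (det-block-tall)

blockEntry : ∀ {s u t v} (X : Fin s → Fin t → ℤ) (α : Fin s → ℤ) (β : Fin v → ℤ) (Y : Fin u → Fin v → ℤ) →
  Fin s ⊎ Fin u → Fin t ⊎ Fin v → ℤ
blockEntry X α β Y (inj₁ x) (inj₁ y) = X x y
blockEntry X α β Y (inj₁ x) (inj₂ y) = α x * β y
blockEntry X α β Y (inj₂ x) (inj₁ y) = 0ℤ
blockEntry X α β Y (inj₂ x) (inj₂ y) = Y x y

block : ∀ {s u t v k} → Shuffle s u k → Shuffle t v k →
  (X : Fin s → Fin t → ℤ) (α : Fin s → ℤ) (β : Fin v → ℤ) (Y : Fin u → Fin v → ℤ) → Matrix k k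
block ρ κ X α β Y i j = blockEntry X α β Y (side ρ i) (side κ j)

blockEntry-map : ∀ {s u t v s′ u′ t′ v′} (X : Fin s → Fin t → ℤ) (α : Fin s → ℤ) (β : Fin v → ℤ)
  (Y : Fin u → Fin v → ℤ) (f : Fin s′ → Fin s) (f′ : Fin u′ → Fin u) (g : Fin t′ → Fin t) (h : Fin v′ → Fin v) p q →
  blockEntry X α β Y (⊎map f f′ p) (⊎map g h q) ≡
  blockEntry (λ a b → X (f a) (g b)) (α ∘ f) (β ∘ h) (λ a b → Y (f′ a) (h b)) p q
blockEntry-map X α β Y f f′ g h (inj₁ x) (inj₁ y) = refl
blockEntry-map X α β Y f f′ g h (inj₁ x) (inj₂ y) = refl
blockEntry-map X α β Y f f′ g h (inj₂ x) (inj₁ y) = refl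
blockEntry-map X α β Y f f′ g h (inj₂ x) (inj₂ y) = refl

dropTopCol : ∀ {s t} → (Fin (suc s) → Fin (suc t) → ℤ) → Fin (suc t) → Fin s → Fin t → ℤ
dropTopCol X x a b = X (suc a) (punchIn x b)

dropTop : ∀ {s t} → (Fin (suc s) → Fin t → ℤ) → Fin s → Fin t → ℤ
dropTop X a b = X (suc a) b

dropCol : ∀ {s t} → (Fin s → Fin (suc t) → ℤ) → Fin (suc t) → Fin s → Fin t → ℤ
dropCol Y y a b = Y a (punchIn y b)

blockEntry-dropTop : ∀ {s u t v} (X : Fin (suc s) → Fin t → ℤ) (α : Fin (suc s) → ℤ) (β : Fin v → ℤ)
  (Y : Fin u → Fin v → ℤ) w w′ → blockEntry X α β Y (⊎map suc id w) w′ ≡ blockEntry (dropTop X) (α ∘ suc) β Y w w′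
blockEntry-dropTop X α β Y (inj₁ x) (inj₁ y) = refl
blockEntry-dropTop X α β Y (inj₁ x) (inj₂ y) = refl
blockEntry-dropTop X α β Y (inj₂ x) (inj₁ y) = refl
blockEntry-dropTop X α β Y (inj₂ x) (inj₂ y) = refl

blockEntry-dropTopʳ : ∀ {s u t v} (X : Fin s → Fin t → ℤ) (α : Fin s → ℤ) (β : Fin v → ℤ)
  (Y : Fin (suc u) → Fin v → ℤ) w w′ → blockEntry X α β Y (⊎map id suc w) w′ ≡ blockEntry X α β (dropTop Y) w w′
blockEntry-dropTopʳ X α β Y (inj₁ x) (inj₁ y) = refl
blockEntry-dropTopʳ X α β Y (inj₁ x) (inj₂ y) = refl
blockEntry-dropTopʳ X α β Y (inj₂ x) (inj₁ y) = refl
blockEntry-dropTopʳ X α β Y (inj₂ x) (inj₂ y) = refl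

-- The four kinds of terms in the expansion along the first row: first row in
-- the top (l) or bottom (r) part, column in the left (l) or right (r) part.
cofactor-ll : ∀ {s u t v k} (ρ : Shuffle s u k) (κ : Shuffle (suc t) v (suc k)) (X : Fin (suc s) → Fin (suc t) → ℤ) α β
  (Y : Fin u → Fin v → ℤ) x →
  cofactorTerm (block (left ρ) κ X α β Y) (posˡ κ x) ≡
  alt (toℕ (posˡ κ x)) * (X zero x * det (block ρ (removeˡ κ x) (dropTopCol X x) (α ∘ suc) β Y))
cofactor-ll ρ κ X α β Y x rewrite side-posˡ κ x = cong (λ w → alt (toℕ (posˡ κ x)) * (X zero x * w))
  (det-cong λ r c → trans (cong (blockEntry X α β Y (⊎map suc id (side ρ r))) (side-removeˡ κ x c))
                          (blockEntry-map X α β Y suc id (punchIn x) id (side ρ r) (side (removeˡ κ x) c)))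

cofactor-lr : ∀ {s u t v k} (ρ : Shuffle s u k) (κ : Shuffle t (suc v) (suc k)) (X : Fin (suc s) → Fin t → ℤ) α β
  (Y : Fin u → Fin (suc v) → ℤ) y →
  cofactorTerm (block (left ρ) κ X α β Y) (posʳ κ y) ≡
  alt (toℕ (posʳ κ y)) * ((α zero * β y) * det (block ρ (removeʳ κ y) (dropTop X) (α ∘ suc) (β ∘ punchIn y) (dropCol Y y)))
cofactor-lr ρ κ X α β Y y rewrite side-posʳ κ y = cong (λ w → alt (toℕ (posʳ κ y)) * ((α zero * β y) * w))
  (det-cong λ r c → trans (cong (blockEntry X α β Y (⊎map suc id (side ρ r))) (side-removeʳ κ y c))
                          (blockEntry-map X α β Y suc id id (punchIn y) (side ρ r) (side (removeʳ κ y) c)))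

cofactor-rl : ∀ {s u t v k} (ρ : Shuffle s u k) (κ : Shuffle t v (suc k)) (X : Fin s → Fin t → ℤ) α β
  (Y : Fin (suc u) → Fin v → ℤ) x →
  cofactorTerm (block (right ρ) κ X α β Y) (posˡ κ x) ≡ 0ℤ
cofactor-rl ρ κ X α β Y x rewrite side-posˡ κ x = *-zeroʳ (alt (toℕ (posˡ κ x)))

cofactor-rr : ∀ {s u t v k} (ρ : Shuffle s u k) (κ : Shuffle t (suc v) (suc k)) (X : Fin s → Fin t → ℤ) α β
  (Y : Fin (suc u) → Fin (suc v) → ℤ) y →
  cofactorTerm (block (right ρ) κ X α β Y) (posʳ κ y) ≡
  alt (toℕ (posʳ κ y)) * (Y zero y * det (block ρ (removeʳ κ y) X α (β ∘ punchIn y) (dropTopCol Y y)))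
cofactor-rr ρ κ X α β Y y rewrite side-posʳ κ y = cong (λ w → alt (toℕ (posʳ κ y)) * (Y zero y * w))
  (det-cong λ r c → trans (cong (blockEntry X α β Y (⊎map id suc (side ρ r))) (side-removeʳ κ y c))
                          (blockEntry-map X α β Y id suc id (punchIn y) (side ρ r) (side (removeʳ κ y) c)))

term-vanishes : ∀ {T} p e {D} → T ≡ alt p * (e * D) → D ≡ 0ℤ → T ≡ 0ℤ
term-vanishes p e {D} eq D≡0 =
  trans eq (trans (cong (λ w → alt p * (e * w)) D≡0) (trans (cong (alt p *_) (*-zeroʳ e)) (*-zeroʳ (alt p))))

-- To prove something about every right (left) item of κ it suffices to treat
-- shuffles whose number of right (left) items is visibly a successor, as the
-- removal operations require.
nonEmptyʳ-elim : ∀ {t k} (P : (v : ℕ) → Shuffle t v k → Fin v → Set) →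
  (∀ {v} (κ : Shuffle t (suc v) k) y → P (suc v) κ y) → ∀ {v} (κ : Shuffle t v k) y → P v κ y
nonEmptyʳ-elim P f κ zero    = f κ zero
nonEmptyʳ-elim P f κ (suc y) = f κ (suc y)

nonEmptyˡ-elim : ∀ {v k} (P : (t : ℕ) → Shuffle t v k → Fin t → Set) →
  (∀ {t} (κ : Shuffle (suc t) v k) x → P (suc t) κ x) → ∀ {t} (κ : Shuffle t v k) x → P t κ x
nonEmptyˡ-elim P f κ zero    = f κ zero
nonEmptyˡ-elim P f κ (suc x) = f κ (suc x)

-- s < t: the t left columns are supported on s < t rows.
det-block-short : ∀ {s u t v k} (ρ : Shuffle s u k) (κ : Shuffle t v k) (X : Fin s → Fin t → ℤ) (α : Fin s → ℤ)
  (β : Fin v → ℤ) (Y : Fin u → Fin v → ℤ) → s ℕ.< t → det (block ρ κ X α β Y) ≡ 0ℤ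
det-block-short done done X α β Y ()
det-block-short {suc s} {u} {suc t} {v} {suc k} (left ρ) κ X α β Y (s≤s s<t) =
  trans (sum-shuffle κ (cofactorTerm (block (left ρ) κ X α β Y)))
        (cong₂ _+_ (sum-zero (suc t) leftTerm) (sum-zero v (λ y → nonEmptyʳ-elim RightTermVanishes rightTerm κ y β Y)))
  where
  leftTerm : ∀ x → cofactorTerm (block (left ρ) κ X α β Y) (posˡ κ x) ≡ 0ℤ
  leftTerm x = term-vanishes (toℕ (posˡ κ x)) (X zero x) (cofactor-ll ρ κ X α β Y x)
                 (det-block-short ρ (removeˡ κ x) (dropTopCol X x) (α ∘ suc) β Y s<t)
  RightTermVanishes : (v : ℕ) → Shuffle (suc t) v (suc k) → Fin v → Set
  RightTermVanishes v κ y = ∀ (β : Fin v → ℤ) (Y : Fin u → Fin v → ℤ) →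
    cofactorTerm (block (left ρ) κ X α β Y) (posʳ κ y) ≡ 0ℤ
  rightTerm : ∀ {v} (κ : Shuffle (suc t) (suc v) (suc k)) y → RightTermVanishes (suc v) κ y
  rightTerm κ y β Y = term-vanishes (toℕ (posʳ κ y)) (α zero * β y) (cofactor-lr ρ κ X α β Y y)
    (det-block-short ρ (removeʳ κ y) (dropTop X) (α ∘ suc) (β ∘ punchIn y) (dropCol Y y) (NP.m≤n⇒m≤1+n s<t))
det-block-short {s} {suc u} {t} {v} {suc k} (right ρ) κ X α β Y s<t =
  trans (sum-shuffle κ (cofactorTerm (block (right ρ) κ X α β Y)))
        (cong₂ _+_ (sum-zero t (cofactor-rl ρ κ X α β Y)) (sum-zero v (λ y → nonEmptyʳ-elim RightTermVanishes rightTerm κ y β Y)))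
  where
  RightTermVanishes : (v : ℕ) → Shuffle t v (suc k) → Fin v → Set
  RightTermVanishes v κ y = ∀ (β : Fin v → ℤ) (Y : Fin (suc u) → Fin v → ℤ) →
    cofactorTerm (block (right ρ) κ X α β Y) (posʳ κ y) ≡ 0ℤ
  rightTerm : ∀ {v} (κ : Shuffle t (suc v) (suc k)) y → RightTermVanishes (suc v) κ y
  rightTerm κ y β Y = term-vanishes (toℕ (posʳ κ y)) (Y zero y) (cofactor-rr ρ κ X α β Y y)
    (det-block-short ρ (removeʳ κ y) X α (β ∘ punchIn y) (dropTopCol Y y) s<t)

-- Sign bookkeeping for one expansion step of the nonvanishing block formulas:
-- the cofactor sign and the sign of the smaller block combine, by
-- sign-removeˡ / sign-removeʳ, into the cofactor sign of X, Y or [β ; Y].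
regroup-leftColumn : ∀ p e sρ s′ D E sκ q → p * s′ ≡ sκ * q →
  p * (e * (sρ * s′ * (D * E))) ≡ (sρ * sκ * E) * (q * (e * D))
regroup-leftColumn p e sρ s′ D E sκ q h =
  trans (pull p e sρ s′ D E) (trans (cong (λ w → w * (sρ * e * D * E)) h) (push sκ q sρ e D E))
  where pull : ∀ p e sρ s′ D E → p * (e * (sρ * s′ * (D * E))) ≡ (p * s′) * (sρ * e * D * E)
        pull = solve-∀
        push : ∀ sκ q sρ e D E → (sκ * q) * (sρ * e * D * E) ≡ (sρ * sκ * E) * (q * (e * D))
        push = solve-∀

regroup-rightColumn : ∀ p e sρ s′ C D sκ f q → p * s′ ≡ sκ * (f * q) →
  p * (e * (sρ * s′ * (C * D))) ≡ (sρ * sκ * f * C) * (q * (e * D))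
regroup-rightColumn p e sρ s′ C D sκ f q h =
  trans (pull p e sρ s′ D C) (trans (cong (λ w → w * (sρ * e * D * C)) h) (push sκ f q sρ e D C))
  where pull : ∀ p e sρ s′ D C → p * (e * (sρ * s′ * (C * D))) ≡ (p * s′) * (sρ * e * D * C)
        pull = solve-∀
        push : ∀ sκ f q sρ e D C → (sκ * (f * q)) * (sρ * e * D * C) ≡ (sρ * sκ * f * C) * (q * (e * D))
        push = solve-∀

regroup-corner : ∀ p a b sρ s′ C D sκ f q → p * s′ ≡ sκ * (f * q) →
  p * ((a * b) * (sρ * s′ * (C * D))) ≡ (sρ * sκ * f * a * C) * (q * (b * D))
regroup-corner p a b sρ s′ C D sκ f q h =
  trans (pull p a b sρ s′ C D) (trans (cong (λ w → w * (sρ * a * b * C * D)) h) (push sκ f q sρ a b C D))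
  where pull : ∀ p a b sρ s′ C D → p * ((a * b) * (sρ * s′ * (C * D))) ≡ (p * s′) * (sρ * a * b * C * D)
        pull = solve-∀
        push : ∀ sκ f q sρ a b C D → (sκ * (f * q)) * (sρ * a * b * C * D) ≡ (sρ * sκ * f * a * C) * (q * (b * D))
        push = solve-∀

det-block-square : ∀ {s u k} (ρ κ : Shuffle s u k) (X : Matrix s s) (α : Fin s → ℤ) (β : Fin u → ℤ) (Y : Matrix u u) →
  det (block ρ κ X α β Y) ≡ shuffleSign ρ * shuffleSign κ * (det X * det Y)
det-block-square done done X α β Y = refl
det-block-square {suc s} {u} {suc k} (left ρ) κ X α β Y =
  trans (sum-shuffle κ (cofactorTerm (block (left ρ) κ X α β Y)))
  (trans (cong₂ _+_ (trans (sum-cong (suc s) leftTerm) (sum-* (suc s) c (cofactorTerm X)))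
                    (sum-zero u (λ y → nonEmptyʳ-elim RightTermVanishes rightTerm κ y β Y)))
         (collect (shuffleSign ρ) (shuffleSign κ) (det X) (det Y)))
  where
  c = shuffleSign ρ * shuffleSign κ * det Y
  leftTerm : ∀ x → cofactorTerm (block (left ρ) κ X α β Y) (posˡ κ x) ≡ c * cofactorTerm X x
  leftTerm x = trans (cofactor-ll ρ κ X α β Y x)
    (trans (cong (λ w → alt (toℕ (posˡ κ x)) * (X zero x * w))
                 (det-block-square ρ (removeˡ κ x) (dropTopCol X x) (α ∘ suc) β Y))
           (regroup-leftColumn (alt (toℕ (posˡ κ x))) (X zero x) (shuffleSign ρ) (shuffleSign (removeˡ κ x))
              (det (dropTopCol X x)) (det Y) (shuffleSign κ) (alt (toℕ x)) (sign-removeˡ κ x)))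
  RightTermVanishes : (v : ℕ) → Shuffle (suc s) v (suc k) → Fin v → Set
  RightTermVanishes v κ y = ∀ (β : Fin v → ℤ) (Y : Fin u → Fin v → ℤ) →
    cofactorTerm (block (left ρ) κ X α β Y) (posʳ κ y) ≡ 0ℤ
  rightTerm : ∀ {v} (κ : Shuffle (suc s) (suc v) (suc k)) y → RightTermVanishes (suc v) κ y
  rightTerm κ y β Y = term-vanishes (toℕ (posʳ κ y)) (α zero * β y) (cofactor-lr ρ κ X α β Y y)
    (det-block-short ρ (removeʳ κ y) (dropTop X) (α ∘ suc) (β ∘ punchIn y) (dropCol Y y) NP.≤-refl)
  collect : ∀ a b c d → a * b * d * c + 0ℤ ≡ a * b * (c * d)
  collect = solve-∀
det-block-square {s} {suc u} {suc k} (right ρ) κ X α β Y =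
  trans (sum-shuffle κ (cofactorTerm (block (right ρ) κ X α β Y)))
  (trans (cong₂ _+_ (sum-zero s (cofactor-rl ρ κ X α β Y))
                    (trans (sum-cong (suc u) rightTerm) (sum-* (suc u) c (cofactorTerm Y))))
         (collect (alt s) (shuffleSign ρ) (shuffleSign κ) (det X) (det Y)))
  where
  c = shuffleSign ρ * shuffleSign κ * alt s * det X
  rightTerm : ∀ y → cofactorTerm (block (right ρ) κ X α β Y) (posʳ κ y) ≡ c * cofactorTerm Y y
  rightTerm y = trans (cofactor-rr ρ κ X α β Y y)
    (trans (cong (λ w → alt (toℕ (posʳ κ y)) * (Y zero y * w))
                 (det-block-square ρ (removeʳ κ y) X α (β ∘ punchIn y) (dropTopCol Y y)))
           (regroup-rightColumn (alt (toℕ (posʳ κ y))) (Y zero y) (shuffleSign ρ) (shuffleSign (removeʳ κ y))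
              (det X) (det (dropTopCol Y y)) (shuffleSign κ) (alt s) (alt (toℕ y)) (sign-removeʳ κ y)))
  collect : ∀ e r k x y → 0ℤ + r * k * e * x * y ≡ e * r * k * (x * y)
  collect = solve-∀

-- The bordered matrix [X | α]: the column α is inserted among the t columns of
-- X at the place prescribed by κP; the sign of κP in `borderDet` compensates
-- for that place.
borderEntry : ∀ {m t} (X : Fin m → Fin t → ℤ) (α : Fin m → ℤ) → Fin m → Fin t ⊎ Fin 1 → ℤ
borderEntry X α i (inj₁ x) = X i x
borderEntry X α i (inj₂ _) = α i

border : ∀ {t} → Shuffle t 1 (suc t) → (X : Fin (suc t) → Fin t → ℤ) (α : Fin (suc t) → ℤ) → Matrix (suc t) (suc t)
border κP X α i j = borderEntry X α i (side κP j)

borderDet : ∀ {t} → Shuffle t 1 (suc t) → (X : Fin (suc t) → Fin t → ℤ) (α : Fin (suc t) → ℤ) → ℤ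
borderDet κP X α = shuffleSign κP * det (border κP X α)

borderEntry-map : ∀ {m t t′} (X : Fin (suc m) → Fin t → ℤ) α (g : Fin t′ → Fin t) (h : Fin 1 → Fin 1) r p →
  borderEntry X α (suc r) (⊎map g h p) ≡ borderEntry (λ a b → X (suc a) (g b)) (α ∘ suc) r p
borderEntry-map X α g h r (inj₁ x) = refl
borderEntry-map X α g h r (inj₂ y) = refl

regroup-borderLeft : ∀ p s′ S q e d → p * s′ ≡ S * q → s′ * s′ ≡ 1ℤ → S * S ≡ 1ℤ →
  S * (p * (e * d)) ≡ q * (e * (s′ * d))
regroup-borderLeft p s′ S q e d h s′² S² =
  trans (cong (λ z → S * (z * (e * d))) p≡)
  (trans (pull S q s′ e d) (trans (cong (λ z → z * (q * (e * (s′ * d)))) S²) (*-identityˡ _)))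
  where
  p≡ : p ≡ S * q * s′
  p≡ = trans (sym (*-identityʳ p)) (trans (cong (p *_) (sym s′²)) (trans (sym (*-assoc p s′ s′)) (cong (_* s′) h)))
  pull : ∀ S q s′ e d → S * (S * q * s′ * (e * d)) ≡ (S * S) * (q * (e * (s′ * d)))
  pull = solve-∀

regroup-borderRight : ∀ p s′ S q w → p * s′ ≡ S * (q * 1ℤ) → s′ ≡ 1ℤ → S * S ≡ 1ℤ → S * (p * w) ≡ q * w
regroup-borderRight p s′ S q w h s′≡1 S² =
  trans (cong (λ z → S * (z * w)) p≡)
  (trans (pull S q w) (trans (cong (λ z → z * (q * w)) S²) (*-identityˡ _)))
  where
  p≡ : p ≡ S * (q * 1ℤ)
  p≡ = trans (sym (*-identityʳ p)) (trans (cong (p *_) (sym s′≡1)) h)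
  pull : ∀ S q w → S * (S * (q * 1ℤ) * w) ≡ (S * S) * (q * w)
  pull = solve-∀

borderDet-expand : ∀ {t} (κP : Shuffle (suc t) 1 (suc (suc t))) (X : Fin (suc (suc t)) → Fin (suc t) → ℤ) α →
  borderDet κP X α ≡ sumFin (suc t) (λ x → alt (toℕ x) * (X zero x * borderDet (removeˡ κP x) (dropTopCol X x) (α ∘ suc)))
                     + alt (suc t) * (α zero * det (dropTop X))
borderDet-expand {t} κP X α =
  trans (cong (shuffleSign κP *_) (sum-shuffle κP (cofactorTerm (border κP X α))))
  (trans (*-distribˡ-+ (shuffleSign κP) _ _)
  (cong₂ _+_
    (trans (sym (sum-* (suc t) (shuffleSign κP) (λ x → cofactorTerm (border κP X α) (posˡ κP x))))
      (sum-cong (suc t) λ x → trans (cong (shuffleSign κP *_) (leftTerm x))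
         (regroup-borderLeft (alt (toℕ (posˡ κP x))) (shuffleSign (removeˡ κP x)) (shuffleSign κP) (alt (toℕ x)) (X zero x)
            (det (border (removeˡ κP x) (dropTopCol X x) (α ∘ suc))) (sign-removeˡ κP x) (sign²≡1 (removeˡ κP x)) (sign²≡1 κP))))
    (trans (cong (λ z → shuffleSign κP * (z + 0ℤ)) borderTerm)
    (trans (cong (shuffleSign κP *_) (+-identityʳ _))
      (regroup-borderRight (alt (toℕ (posʳ κP zero))) (shuffleSign (removeʳ κP zero)) (shuffleSign κP) (alt (suc t))
         (α zero * det (dropTop X)) (sign-removeʳ κP zero) (sign-noRight (removeʳ κP zero)) (sign²≡1 κP))))))
  where
  leftTerm : ∀ x → cofactorTerm (border κP X α) (posˡ κP x) ≡
    alt (toℕ (posˡ κP x)) * (X zero x * det (border (removeˡ κP x) (dropTopCol X x) (α ∘ suc)))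
  leftTerm x rewrite side-posˡ κP x = cong (λ w → alt (toℕ (posˡ κP x)) * (X zero x * w))
    (det-cong λ r c → trans (cong (borderEntry X α (suc r)) (side-removeˡ κP x c))
                            (borderEntry-map X α (punchIn x) id r (side (removeˡ κP x) c)))
  borderTerm : cofactorTerm (border κP X α) (posʳ κP zero) ≡ alt (toℕ (posʳ κP zero)) * (α zero * det (dropTop X))
  borderTerm rewrite side-posʳ κP zero = cong (λ w → alt (toℕ (posʳ κP zero)) * (α zero * w))
    (det-cong λ r c → trans (cong (borderEntry X α (suc r)) (side-removeʳ κP zero c))
                            (cong (λ p → borderEntry X α (suc r) (⊎map id (punchIn zero) p)) (side-noRight (removeʳ κP zero) c)))

det-block-border : ∀ {t u k} (ρ : Shuffle (suc t) u k) (κ : Shuffle t (suc u) k) (κP : Shuffle t 1 (suc t))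
  (X : Fin (suc t) → Fin t → ℤ) (α : Fin (suc t) → ℤ) (β : Fin (suc u) → ℤ) (Y : Fin u → Fin (suc u) → ℤ) →
  det (block ρ κ X α β Y) ≡ shuffleSign ρ * shuffleSign κ * (borderDet κP X α * det (prependRow β Y))
det-block-border {zero} {u} {suc k} (left ρ) κ (right done) X α β Y =
  trans (sum-shuffle κ (cofactorTerm (block (left ρ) κ X α β Y)))
  (trans (cong (0ℤ +_) (trans (sum-cong (suc u) rightTerm) (sum-* (suc u) c (cofactorTerm (prependRow β Y)))))
         (collect (shuffleSign ρ) (shuffleSign κ) (α zero) (det (prependRow β Y))))
  where
  c = shuffleSign ρ * shuffleSign κ * alt zero * α zero * det (dropTop X)
  rightTerm : ∀ y → cofactorTerm (block (left ρ) κ X α β Y) (posʳ κ y) ≡ c * cofactorTerm (prependRow β Y) y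
  rightTerm y = trans (cofactor-lr ρ κ X α β Y y)
    (trans (cong (λ w → alt (toℕ (posʳ κ y)) * ((α zero * β y) * w))
                 (det-block-square ρ (removeʳ κ y) (dropTop X) (α ∘ suc) (β ∘ punchIn y) (dropCol Y y)))
           (regroup-corner (alt (toℕ (posʳ κ y))) (α zero) (β y) (shuffleSign ρ) (shuffleSign (removeʳ κ y))
              (det (dropTop X)) (det (dropCol Y y)) (shuffleSign κ) (alt zero) (alt (toℕ y)) (sign-removeʳ κ y)))
  collect : ∀ sρ sκ a q → 0ℤ + sρ * sκ * 1ℤ * a * 1ℤ * q ≡ sρ * sκ * (1ℤ * (1ℤ * (a * 1ℤ) + 0ℤ) * q)
  collect = solve-∀
det-block-border {suc t} {u} {suc k} (left ρ) κ κP X α β Y =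
  trans (sum-shuffle κ (cofactorTerm (block (left ρ) κ X α β Y)))
  (trans (cong₂ _+_ (trans (sum-cong (suc t) leftTerm) (sum-* (suc t) c (λ x → alt (toℕ x) * (X zero x * smaller x))))
                    (trans (sum-cong (suc u) rightTerm) (sum-* (suc u) c′ (cofactorTerm (prependRow β Y)))))
  (trans (collect (shuffleSign ρ) (shuffleSign κ) (det (prependRow β Y)) (sumFin (suc t) (λ x → alt (toℕ x) * (X zero x * smaller x)))
                  (alt (suc t)) (α zero) (det (dropTop X)))
         (cong (λ w → shuffleSign ρ * shuffleSign κ * (w * det (prependRow β Y))) (sym (borderDet-expand κP X α)))))
  where
  smaller : Fin (suc t) → ℤ
  smaller x = borderDet (removeˡ κP x) (dropTopCol X x) (α ∘ suc)
  c  = shuffleSign ρ * shuffleSign κ * det (prependRow β Y)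
  c′ = shuffleSign ρ * shuffleSign κ * alt (suc t) * α zero * det (dropTop X)
  leftTerm : ∀ x → cofactorTerm (block (left ρ) κ X α β Y) (posˡ κ x) ≡ c * (alt (toℕ x) * (X zero x * smaller x))
  leftTerm x = trans (cofactor-ll ρ κ X α β Y x)
    (trans (cong (λ w → alt (toℕ (posˡ κ x)) * (X zero x * w))
                 (det-block-border ρ (removeˡ κ x) (removeˡ κP x) (dropTopCol X x) (α ∘ suc) β Y))
           (regroup-leftColumn (alt (toℕ (posˡ κ x))) (X zero x) (shuffleSign ρ) (shuffleSign (removeˡ κ x))
              (smaller x) (det (prependRow β Y)) (shuffleSign κ) (alt (toℕ x)) (sign-removeˡ κ x)))
  rightTerm : ∀ y → cofactorTerm (block (left ρ) κ X α β Y) (posʳ κ y) ≡ c′ * cofactorTerm (prependRow β Y) y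
  rightTerm y = trans (cofactor-lr ρ κ X α β Y y)
    (trans (cong (λ w → alt (toℕ (posʳ κ y)) * ((α zero * β y) * w))
                 (det-block-square ρ (removeʳ κ y) (dropTop X) (α ∘ suc) (β ∘ punchIn y) (dropCol Y y)))
           (regroup-corner (alt (toℕ (posʳ κ y))) (α zero) (β y) (shuffleSign ρ) (shuffleSign (removeʳ κ y))
              (det (dropTop X)) (det (dropCol Y y)) (shuffleSign κ) (alt (suc t)) (alt (toℕ y)) (sign-removeʳ κ y)))
  collect : ∀ sρ sκ q S f a d → sρ * sκ * q * S + sρ * sκ * f * a * d * q ≡ sρ * sκ * ((S + f * (a * d)) * q)
  collect = solve-∀
det-block-border {t} {suc u} {suc k} (right ρ) κ κP X α β Y =
  trans (sum-shuffle κ (cofactorTerm (block (right ρ) κ X α β Y)))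
  (trans (cong₂ _+_ (sum-zero t (cofactor-rl ρ κ X α β Y))
                    (trans (sum-cong (suc (suc u)) rightTerm)
                    (trans (sum-* (suc (suc u)) c (cofactorTerm (swapTop (prependRow β Y))))
                           (cong (c *_) (det-swapTop (prependRow β Y))))))
         (collect (shuffleSign ρ) (shuffleSign κ) (alt t) (borderDet κP X α) (det (prependRow β Y))))
  where
  -- The remaining rows are those of Y, with β in second place.
  c = shuffleSign ρ * shuffleSign κ * alt t * borderDet κP X α
  minor-swapped : ∀ y r c → minor (swapTop (prependRow β Y)) y r c ≡ prependRow (β ∘ punchIn y) (dropTopCol Y y) r c
  minor-swapped y zero    c = refl
  minor-swapped y (suc r) c = refl
  rightTerm : ∀ y → cofactorTerm (block (right ρ) κ X α β Y) (posʳ κ y) ≡ c * cofactorTerm (swapTop (prependRow β Y)) y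
  rightTerm y = trans (cofactor-rr ρ κ X α β Y y)
    (trans (cong (λ w → alt (toℕ (posʳ κ y)) * (Y zero y * w))
                 (trans (det-block-border ρ (removeʳ κ y) κP X α (β ∘ punchIn y) (dropTopCol Y y))
                        (cong (λ D → shuffleSign ρ * shuffleSign (removeʳ κ y) * (borderDet κP X α * D))
                              (sym (det-cong (minor-swapped y))))))
           (regroup-rightColumn (alt (toℕ (posʳ κ y))) (Y zero y) (shuffleSign ρ) (shuffleSign (removeʳ κ y))
              (borderDet κP X α) (det (minor (swapTop (prependRow β Y)) y)) (shuffleSign κ) (alt t) (alt (toℕ y)) (sign-removeʳ κ y)))
  collect : ∀ sρ sκ f P q → 0ℤ + sρ * sκ * f * P * (- q) ≡ (- f) * sρ * sκ * (P * q)
  collect = solve-∀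

-- With exactly t + 2 top rows, the terms of the first-row expansion taken in
-- the right columns are border determinants; they assemble into
-- ± det [β ; β ; Y] = 0.
shuffle-sizes : ∀ {t u v k} → suc t ℕ.+ u ≡ k → t ℕ.+ suc v ≡ suc k → v ≡ suc u
shuffle-sizes {t} {u} {v} {k} e₁ e₂ = NP.+-cancelˡ-≡ t v (suc u)
  (NP.suc-injective (trans (sym (NP.+-suc t v)) (trans e₂ (trans (cong suc (sym e₁)) (cong suc (sym (NP.+-suc t u)))))))

rightTerms-cancel : ∀ {t u v k} (ρ : Shuffle (suc t) u k) (κ : Shuffle t v (suc k)) (X : Fin (suc (suc t)) → Fin t → ℤ)
  (α : Fin (suc (suc t)) → ℤ) (β : Fin v → ℤ) (Y : Fin u → Fin v → ℤ) →
  sumFin v (λ y → cofactorTerm (block (left ρ) κ X α β Y) (posʳ κ y)) ≡ 0ℤ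
rightTerms-cancel {v = zero}  ρ κ X α β Y = refl
rightTerms-cancel {t} {u} {suc v} {k} ρ κ X α β Y = cancel (shuffle-sizes (shuffle-size ρ) (shuffle-size κ)) κ β Y
  where
  cancel : ∀ {v} → v ≡ suc u → (κ : Shuffle t (suc v) (suc k)) (β : Fin (suc v) → ℤ) (Y : Fin u → Fin (suc v) → ℤ) →
    sumFin (suc v) (λ y → cofactorTerm (block (left ρ) κ X α β Y) (posʳ κ y)) ≡ 0ℤ
  cancel refl κ β Y =
    trans (sum-cong (suc (suc u)) rightTerm)
    (trans (sum-* (suc (suc u)) c (cofactorTerm twoβ))
    (trans (cong (c *_) (det-equalTopRows twoβ (λ _ → refl))) (*-zeroʳ c)))
    where
    twoβ : Matrix (suc (suc u)) (suc (suc u))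
    twoβ = prependRow β (prependRow β Y)
    P = borderDet (lastRight t) (dropTop X) (α ∘ suc)
    c = shuffleSign ρ * shuffleSign κ * alt t * α zero * P
    minor-twoβ : ∀ y r c → minor twoβ y r c ≡ prependRow (β ∘ punchIn y) (dropCol Y y) r c
    minor-twoβ y zero    c = refl
    minor-twoβ y (suc r) c = refl
    rightTerm : ∀ y → cofactorTerm (block (left ρ) κ X α β Y) (posʳ κ y) ≡ c * cofactorTerm twoβ y
    rightTerm y = trans (cofactor-lr ρ κ X α β Y y)
      (trans (cong (λ w → alt (toℕ (posʳ κ y)) * ((α zero * β y) * w))
                   (trans (det-block-border ρ (removeʳ κ y) (lastRight t) (dropTop X) (α ∘ suc) (β ∘ punchIn y) (dropCol Y y))
                          (cong (λ D → shuffleSign ρ * shuffleSign (removeʳ κ y) * (P * D)) (sym (det-cong (minor-twoβ y))))))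
             (regroup-corner (alt (toℕ (posʳ κ y))) (α zero) (β y) (shuffleSign ρ) (shuffleSign (removeʳ κ y))
                P (det (minor twoβ y)) (shuffleSign κ) (alt t) (alt (toℕ y)) (sign-removeʳ κ y)))

-- s ≥ t + 2: the top part [X | α β] has rank ≤ t + 1 < s.
det-block-tall : ∀ {s u t v k} (ρ : Shuffle s u k) (κ : Shuffle t v k) (X : Fin s → Fin t → ℤ) (α : Fin s → ℤ)
  (β : Fin v → ℤ) (Y : Fin u → Fin v → ℤ) → suc (suc t) ℕ.≤ s → det (block ρ κ X α β Y) ≡ 0ℤ
det-block-tall {s} {suc u} {t} {v} {suc k} (right ρ) κ X α β Y t+2≤s =
  trans (sum-shuffle κ (cofactorTerm (block (right ρ) κ X α β Y)))
        (cong₂ _+_ (sum-zero t (cofactor-rl ρ κ X α β Y)) (sum-zero v (λ y → nonEmptyʳ-elim RightTermVanishes rightTerm κ y β Y)))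
  where
  RightTermVanishes : (v : ℕ) → Shuffle t v (suc k) → Fin v → Set
  RightTermVanishes v κ y = ∀ (β : Fin v → ℤ) (Y : Fin (suc u) → Fin v → ℤ) →
    cofactorTerm (block (right ρ) κ X α β Y) (posʳ κ y) ≡ 0ℤ
  rightTerm : ∀ {v} (κ : Shuffle t (suc v) (suc k)) y → RightTermVanishes (suc v) κ y
  rightTerm κ y β Y = term-vanishes (toℕ (posʳ κ y)) (Y zero y) (cofactor-rr ρ κ X α β Y y)
    (det-block-tall ρ (removeʳ κ y) X α (β ∘ punchIn y) (dropTopCol Y y) t+2≤s)
det-block-tall {suc s} {u} {t} {v} {suc k} (left ρ) κ X α β Y (s≤s t+1≤s) =
  trans (sum-shuffle κ (cofactorTerm (block (left ρ) κ X α β Y)))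
        (cong₂ _+_ (sum-zero t (λ x → nonEmptyˡ-elim LeftTermVanishes leftTerm κ x t+1≤s X)) rightTerms)
  where
  LeftTermVanishes : (t : ℕ) → Shuffle t v (suc k) → Fin t → Set
  LeftTermVanishes t κ x = suc t ℕ.≤ s → ∀ (X : Fin (suc s) → Fin t → ℤ) →
    cofactorTerm (block (left ρ) κ X α β Y) (posˡ κ x) ≡ 0ℤ
  leftTerm : ∀ {t} (κ : Shuffle (suc t) v (suc k)) x → LeftTermVanishes (suc t) κ x
  leftTerm κ x t+2≤s X = term-vanishes (toℕ (posˡ κ x)) (X zero x) (cofactor-ll ρ κ X α β Y x)
    (det-block-tall ρ (removeˡ κ x) (dropTopCol X x) (α ∘ suc) β Y t+2≤s)
  RightTermVanishes : (v : ℕ) → Shuffle t v (suc k) → Fin v → Set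
  RightTermVanishes v κ y = suc (suc t) ℕ.≤ s → ∀ (β : Fin v → ℤ) (Y : Fin u → Fin v → ℤ) →
    cofactorTerm (block (left ρ) κ X α β Y) (posʳ κ y) ≡ 0ℤ
  rightTerm : ∀ {v} (κ : Shuffle t (suc v) (suc k)) y → RightTermVanishes (suc v) κ y
  rightTerm κ y t+2≤s β Y = term-vanishes (toℕ (posʳ κ y)) (α zero * β y) (cofactor-lr ρ κ X α β Y y)
    (det-block-tall ρ (removeʳ κ y) (dropTop X) (α ∘ suc) (β ∘ punchIn y) (dropCol Y y) t+2≤s)
  -- When s = t + 1 the remaining rows are in the border case and the right
  -- terms cancel instead of vanishing individually.
  rightTerms : sumFin v (λ y → cofactorTerm (block (left ρ) κ X α β Y) (posʳ κ y)) ≡ 0ℤ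
  rightTerms with NP.m≤n⇒m<n∨m≡n t+1≤s
  ... | inj₁ t+2≤s = sum-zero v (λ y → nonEmptyʳ-elim RightTermVanishes rightTerm κ y t+2≤s β Y)
  ... | inj₂ refl  = rightTerms-cancel ρ κ X α β Y

ZeroOrUnit : ℤ → Set
ZeroOrUnit x = (x ≡ 0ℤ) ⊎ (x ≡ 1ℤ) ⊎ (x ≡ -1ℤ)

zu-zero : ZeroOrUnit 0ℤ
zu-zero = inj₁ refl

zu-neg : ∀ {x} → ZeroOrUnit x → ZeroOrUnit (- x)
zu-neg (inj₁ refl)        = inj₁ refl
zu-neg (inj₂ (inj₁ refl)) = inj₂ (inj₂ refl)
zu-neg (inj₂ (inj₂ refl)) = inj₂ (inj₁ refl)

zu-* : ∀ {x y} → ZeroOrUnit x → ZeroOrUnit y → ZeroOrUnit (x * y)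
zu-*         (inj₁ refl)        _  = inj₁ refl
zu-* {y = y} (inj₂ (inj₁ refl)) hy = subst ZeroOrUnit (sym (*-identityˡ y)) hy
zu-* {y = y} (inj₂ (inj₂ refl)) hy = subst ZeroOrUnit (sym (-1*i≡-i y)) (zu-neg hy)

alt-zu : ∀ k → ZeroOrUnit (alt k)
alt-zu zero    = inj₂ (inj₁ refl)
alt-zu (suc k) = zu-neg (alt-zu k)

sign-zu : ∀ {a b k} (κ : Shuffle a b k) → ZeroOrUnit (shuffleSign κ)
sign-zu done          = inj₂ (inj₁ refl)
sign-zu (left κ)      = sign-zu κ
sign-zu (right {a} κ) = zu-* (alt-zu a) (sign-zu κ)

TU-resp : ∀ {m n} {M N : Matrix m n} → (∀ i j → M i j ≡ N i j) → TU M → TU N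
TU-resp e h k r c r-inj c-inj = subst ZeroOrUnit (det-cong (λ x y → e (r x) (c y))) (h k r c r-inj c-inj)

-- Splitting a choice of rows (or columns) of a 2-sum.  A map r into
-- Fin (m + p) picks indices of the first and of the second part, in an
-- interleaved order recorded by a shuffle ρ.

record IndexSplit (m p k : ℕ) (r : Fin k → Fin (m ℕ.+ p)) : Set where
  field
    s u    : ℕ
    ρ      : Shuffle s u k
    pickˡ  : Fin s → Fin m
    pickʳ  : Fin u → Fin p
    splits : ∀ i → splitAt m (r i) ≡ ⊎map pickˡ pickʳ (side ρ i)

splitIndex : ∀ {m p} k (r : Fin k → Fin (m ℕ.+ p)) → IndexSplit m p k r
splitIndex zero r = record { s = 0 ; u = 0 ; ρ = done ; pickˡ = λ () ; pickʳ = λ () ; splits = λ () }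
splitIndex {m} {p} (suc k) r with splitIndex k (r ∘ suc) | splitAt m (r zero) in eq
... | R | inj₁ x = record
  { s = suc s ; u = u ; ρ = left ρ ; pickˡ = x ∷ pickˡ ; pickʳ = pickʳ ; splits = λ where
      zero    → eq
      (suc i) → trans (splits i) (sym (map-map {f = suc} {g = id} {f′ = x ∷ pickˡ} {g′ = pickʳ} (side ρ i))) }
  where open IndexSplit R
... | R | inj₂ y = record
  { s = s ; u = suc u ; ρ = right ρ ; pickˡ = pickˡ ; pickʳ = y ∷ pickʳ ; splits = λ where
      zero    → eq
      (suc i) → trans (splits i) (sym (map-map {f = id} {g = suc} {f′ = pickˡ} {g′ = y ∷ pickʳ} (side ρ i))) }
  where open IndexSplit R

module _ {m p k} {r : Fin k → Fin (m ℕ.+ p)} (R : IndexSplit m p k r) (r-inj : Injective _≡_ _≡_ r) where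
  open IndexSplit R

  pickˡ-injective : Injective _≡_ _≡_ pickˡ
  pickˡ-injective {x} {y} e = inj₁-injective (begin
    inj₁ x                  ≡⟨ side-posˡ ρ x ⟨
    side ρ (posˡ ρ x)       ≡⟨ cong (side ρ) (r-inj (trans (sym (embed x)) (trans (cong (_↑ˡ p) e) (embed y)))) ⟩
    side ρ (posˡ ρ y)       ≡⟨ side-posˡ ρ y ⟩
    inj₁ y                  ∎)
    where
    open ≡-Reasoning
    embed : ∀ x → pickˡ x ↑ˡ p ≡ r (posˡ ρ x)
    embed x = splitAt⁻¹-↑ˡ (trans (splits (posˡ ρ x)) (cong (⊎map pickˡ pickʳ) (side-posˡ ρ x)))

  pickʳ-injective : Injective _≡_ _≡_ pickʳ
  pickʳ-injective {x} {y} e = inj₂-injective (begin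
    inj₂ x                  ≡⟨ side-posʳ ρ x ⟨
    side ρ (posʳ ρ x)       ≡⟨ cong (side ρ) (r-inj (trans (sym (embed x)) (trans (cong (m ↑ʳ_) e) (embed y)))) ⟩
    side ρ (posʳ ρ y)       ≡⟨ side-posʳ ρ y ⟩
    inj₂ y                  ∎)
    where
    open ≡-Reasoning
    embed : ∀ y → m ↑ʳ pickʳ y ≡ r (posʳ ρ y)
    embed y = splitAt⁻¹-↑ʳ (trans (splits (posʳ ρ y)) (cong (⊎map pickˡ pickʳ) (side-posʳ ρ y)))

twoSum-view : ∀ {m n p q} (A' : Matrix m n) a b (B' : Matrix p q) i j →
  twoSum A' a b B' i j ≡ blockEntry A' a b B' (splitAt m i) (splitAt n j)
twoSum-view {m} {n} A' a b B' i j with splitAt m i | splitAt n j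
... | inj₁ _ | inj₁ _ = refl
... | inj₁ _ | inj₂ _ = refl
... | inj₂ _ | inj₁ _ = refl
... | inj₂ _ | inj₂ _ = refl

appendCol-view : ∀ {m n} (A' : Matrix m n) a i j → appendCol A' a i j ≡ borderEntry A' a i (splitAt n j)
appendCol-view {n = n} A' a i j with splitAt n j
... | inj₁ _ = refl
... | inj₂ _ = refl

appendCol-join : ∀ {m n} (A' : Matrix m n) a i w → appendCol A' a i (join n 1 w) ≡ borderEntry A' a i w
appendCol-join {n = n} A' a i w = trans (appendCol-view A' a i (join n 1 w)) (cong (borderEntry A' a i) (splitAt-join n 1 w))

join-injective : ∀ n k → Injective _≡_ _≡_ (join n k)
join-injective n k {w} {w′} e = trans (sym (splitAt-join n k w)) (trans (cong (splitAt n) e) (splitAt-join n k w′))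

⊎map-injective : ∀ {A B C D : Set} {f : A → C} {g : B → D} →
  Injective _≡_ _≡_ f → Injective _≡_ _≡_ g → Injective _≡_ _≡_ (⊎map f g)
⊎map-injective f-inj g-inj {inj₁ x} {inj₁ y} e = cong inj₁ (f-inj (inj₁-injective e))
⊎map-injective f-inj g-inj {inj₂ x} {inj₂ y} e = cong inj₂ (g-inj (inj₂-injective e))

twoSumBlock : ∀ {m n p q s u t v k} (A' : Matrix m n) (a : Fin m → ℤ) (b : Fin q → ℤ) (B' : Matrix p q) →
  Shuffle s u k → Shuffle t v k → (Fin s → Fin m) → (Fin u → Fin p) → (Fin t → Fin n) → (Fin v → Fin q) → Matrix k k
twoSumBlock A' a b B' ρ κ rˡ rʳ cˡ cʳ = block ρ κ (λ x y → A' (rˡ x) (cˡ y)) (a ∘ rˡ) (b ∘ cʳ) (λ x y → B' (rʳ x) (cʳ y))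

twoSum-submatrix : ∀ {m n p q k} (A' : Matrix m n) a b (B' : Matrix p q)
  {r : Fin k → Fin (m ℕ.+ p)} {c : Fin k → Fin (n ℕ.+ q)} (R : IndexSplit m p k r) (C : IndexSplit n q k c) →
  ∀ i j → submatrix (twoSum A' a b B') r c i j ≡
          twoSumBlock A' a b B' (IndexSplit.ρ R) (IndexSplit.ρ C) (IndexSplit.pickˡ R) (IndexSplit.pickʳ R)
                      (IndexSplit.pickˡ C) (IndexSplit.pickʳ C) i j
twoSum-submatrix A' a b B' {r} {c} R C i j =
  trans (twoSum-view A' a b B' (r i) (c j))
  (trans (cong₂ (blockEntry A' a b B') (IndexSplit.splits R i) (IndexSplit.splits C j))
         (blockEntry-map A' a b B' (IndexSplit.pickˡ R) (IndexSplit.pickʳ R) (IndexSplit.pickˡ C) (IndexSplit.pickʳ C)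
            (side (IndexSplit.ρ R) i) (side (IndexSplit.ρ C) j)))

-- By the block formulas, the determinant of a
-- square submatrix is 0 or a product of signs and of determinants of square
-- submatrices of A', [A' a] (containing the column a), B' and [b ; B']
-- (containing the row b).
module TwoSumTU {m n p q : ℕ} (A' : Matrix m n) (a : Fin m → ℤ) (b : Fin q → ℤ) (B' : Matrix p q)
  (hA : TU (appendCol A' a)) (hB : TU (prependRow b B')) where

  det-A'-zu : ∀ {s} (rˡ : Fin s → Fin m) (cˡ : Fin s → Fin n) → Injective _≡_ _≡_ rˡ → Injective _≡_ _≡_ cˡ →
    ZeroOrUnit (det (λ x y → A' (rˡ x) (cˡ y)))
  det-A'-zu {s} rˡ cˡ rˡ-inj cˡ-inj =
    subst ZeroOrUnit (det-cong λ x y → appendCol-join A' a (rˡ x) (inj₁ (cˡ y)))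
          (hA s rˡ (λ y → join n 1 (inj₁ (cˡ y))) rˡ-inj (cˡ-inj ∘ inj₁-injective ∘ join-injective n 1))

  det-B'-zu : ∀ {u} (rʳ : Fin u → Fin p) (cʳ : Fin u → Fin q) → Injective _≡_ _≡_ rʳ → Injective _≡_ _≡_ cʳ →
    ZeroOrUnit (det (λ x y → B' (rʳ x) (cʳ y)))
  det-B'-zu {u} rʳ cʳ rʳ-inj cʳ-inj = hB u (suc ∘ rʳ) cʳ (rʳ-inj ∘ suc-injective) cʳ-inj

  borderDet-zu : ∀ {t} (κP : Shuffle t 1 (suc t)) (rˡ : Fin (suc t) → Fin m) (cˡ : Fin t → Fin n) →
    Injective _≡_ _≡_ rˡ → Injective _≡_ _≡_ cˡ → ZeroOrUnit (borderDet κP (λ x y → A' (rˡ x) (cˡ y)) (a ∘ rˡ))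
  borderDet-zu {t} κP rˡ cˡ rˡ-inj cˡ-inj = zu-* (sign-zu κP) (subst ZeroOrUnit (det-cong entries)
    (hA (suc t) rˡ (λ j → join n 1 (⊎map cˡ id (side κP j))) rˡ-inj
        (side-injective κP ∘ ⊎map-injective cˡ-inj id ∘ join-injective n 1)))
    where
    restrict : ∀ i w → borderEntry A' a (rˡ i) (⊎map cˡ id w) ≡ borderEntry (λ x y → A' (rˡ x) (cˡ y)) (a ∘ rˡ) i w
    restrict i (inj₁ x) = refl
    restrict i (inj₂ y) = refl
    entries : ∀ i j → appendCol A' a (rˡ i) (join n 1 (⊎map cˡ id (side κP j))) ≡ border κP (λ x y → A' (rˡ x) (cˡ y)) (a ∘ rˡ) i j
    entries i j = trans (appendCol-join A' a (rˡ i) (⊎map cˡ id (side κP j))) (restrict i (side κP j))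

  det-prependRow-zu : ∀ {u} (rʳ : Fin u → Fin p) (cʳ : Fin (suc u) → Fin q) → Injective _≡_ _≡_ rʳ → Injective _≡_ _≡_ cʳ →
    ZeroOrUnit (det (prependRow (b ∘ cʳ) (λ x y → B' (rʳ x) (cʳ y))))
  det-prependRow-zu {u} rʳ cʳ rʳ-inj cʳ-inj = subst ZeroOrUnit (det-cong entries) (hB (suc u) rows cʳ rows-inj cʳ-inj)
    where
    rows : Fin (suc u) → Fin (suc p)
    rows = zero ∷ (suc ∘ rʳ)
    rows-inj : Injective _≡_ _≡_ rows
    rows-inj {zero}  {zero}  e = refl
    rows-inj {suc x} {suc y} e = cong suc (rʳ-inj (suc-injective e))
    entries : ∀ i j → submatrix (prependRow b B') rows cʳ i j ≡ prependRow (b ∘ cʳ) (λ x y → B' (rʳ x) (cʳ y)) i j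
    entries zero    j = refl
    entries (suc i) j = refl

  det-block-zu : ∀ {s u t v k} (ρ : Shuffle s u k) (κ : Shuffle t v k) (rˡ : Fin s → Fin m) (rʳ : Fin u → Fin p)
    (cˡ : Fin t → Fin n) (cʳ : Fin v → Fin q) →
    Injective _≡_ _≡_ rˡ → Injective _≡_ _≡_ rʳ → Injective _≡_ _≡_ cˡ → Injective _≡_ _≡_ cʳ →
    ZeroOrUnit (det (twoSumBlock A' a b B' ρ κ rˡ rʳ cˡ cʳ))
  det-block-zu {s} {u} {t} {v} ρ κ rˡ rʳ cˡ cʳ rˡ-inj rʳ-inj cˡ-inj cʳ-inj with NP.<-cmp s t
  ... | tri< s<t _ _ = subst ZeroOrUnit (sym (det-block-short ρ κ _ _ _ _ s<t)) zu-zero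
  ... | tri≈ _ refl _ with NP.+-cancelˡ-≡ s u v (trans (shuffle-size ρ) (sym (shuffle-size κ)))
  ...   | refl = subst ZeroOrUnit (sym (det-block-square ρ κ _ _ _ _))
                   (zu-* (zu-* (sign-zu ρ) (sign-zu κ)) (zu-* (det-A'-zu rˡ cˡ rˡ-inj cˡ-inj) (det-B'-zu rʳ cʳ rʳ-inj cʳ-inj)))
  det-block-zu {s} {u} {t} {v} ρ κ rˡ rʳ cˡ cʳ rˡ-inj rʳ-inj cˡ-inj cʳ-inj | tri> _ _ t<s with NP.m≤n⇒m<n∨m≡n t<s
  ... | inj₁ t+2≤s = subst ZeroOrUnit (sym (det-block-tall ρ κ _ _ _ _ t+2≤s)) zu-zero
  ... | inj₂ refl with NP.+-cancelˡ-≡ t v (suc u) (trans (shuffle-size κ) (trans (sym (shuffle-size ρ)) (sym (NP.+-suc t u))))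
  ...   | refl = subst ZeroOrUnit (sym (det-block-border ρ κ (lastRight t) _ _ _ _))
                   (zu-* (zu-* (sign-zu ρ) (sign-zu κ))
                         (zu-* (borderDet-zu (lastRight t) rˡ cˡ rˡ-inj cˡ-inj) (det-prependRow-zu rʳ cʳ rʳ-inj cʳ-inj)))

  twoSum-TU : TU (twoSum A' a b B')
  twoSum-TU k r c r-inj c-inj = subst ZeroOrUnit (sym (det-cong (twoSum-submatrix A' a b B' R C)))
    (det-block-zu (ρ R) (ρ C) (pickˡ R) (pickʳ R) (pickˡ C) (pickʳ C)
       (pickˡ-injective R r-inj) (pickʳ-injective R r-inj) (pickˡ-injective C c-inj) (pickʳ-injective C c-inj))
    where
    open IndexSplit
    R = splitIndex k r
    C = splitIndex k c

IsUnit : ℤ → Set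
IsUnit x = x ≡ 1ℤ ⊎ x ≡ -1ℤ

zeroEntry-at : ∀ {m n} (M : Matrix m n) i j → zeroEntry M i j i j ≡ 0ℤ
zeroEntry-at M i j with i ≟ i | j ≟ j
... | yes _ | yes _  = refl
... | no i≢i | _     = ⊥-elim (i≢i refl)
... | yes _ | no j≢j = ⊥-elim (j≢j refl)

zeroEntry-elsewhere : ∀ {m n} (M : Matrix m n) i j r c → (r ≡ i → c ≡ j → ⊥) → zeroEntry M i j r c ≡ M r c
zeroEntry-elsewhere M i j r c ne with r ≟ i | c ≟ j
... | yes r≡i | yes c≡j = ⊥-elim (ne r≡i c≡j)
... | yes _   | no _    = refl
... | no _    | _       = refl

zeroEntry-unique : ∀ {m n} (N M : Matrix m n) i j → N i j ≡ 0ℤ → (∀ r c → (r ≡ i → c ≡ j → ⊥) → N r c ≡ M r c) →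
  ∀ r c → zeroEntry M i j r c ≡ N r c
zeroEntry-unique N M i j N₀ N-elsewhere r c with r ≟ i | c ≟ j
... | yes refl | yes refl = sym N₀
... | yes _    | no c≢j   = sym (N-elsewhere r c (λ _ → c≢j))
... | no r≢i   | _        = sym (N-elsewhere r c (λ r≡i _ → r≢i r≡i))

zeroEntry-appendCol : ∀ {m n} (A' : Matrix m n) a i j →
  ∀ r c → zeroEntry (appendCol A' a) i (j ↑ˡ 1) r c ≡ appendCol (zeroEntry A' i j) a r c
zeroEntry-appendCol {n = n} A' a i j = zeroEntry-unique (appendCol (zeroEntry A' i j) a) (appendCol A' a) i (j ↑ˡ 1)
  (trans (appendCol-view (zeroEntry A' i j) a i (j ↑ˡ 1))
         (trans (cong (borderEntry (zeroEntry A' i j) a i) (splitAt-↑ˡ n j 1)) (zeroEntry-at A' i j)))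
  (λ r c ne → trans (appendCol-view (zeroEntry A' i j) a r c)
                    (trans (same r c ne (splitAt n c) refl) (sym (appendCol-view A' a r c))))
  where
  same : ∀ r c → (r ≡ i → c ≡ j ↑ˡ 1 → ⊥) → ∀ w → splitAt n c ≡ w →
    borderEntry (zeroEntry A' i j) a r w ≡ borderEntry A' a r w
  same r c ne (inj₁ c′) c≡ = zeroEntry-elsewhere A' i j r c′ (λ r≡i c′≡j → ne r≡i (trans (sym (splitAt⁻¹-↑ˡ c≡)) (cong (_↑ˡ 1) c′≡j)))
  same r c ne (inj₂ _)  c≡ = refl

zeroEntry-prependRow : ∀ {p q} (b : Fin q → ℤ) (B' : Matrix p q) i j →
  ∀ r c → zeroEntry (prependRow b B') (suc i) j r c ≡ prependRow b (zeroEntry B' i j) r c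
zeroEntry-prependRow b B' i j = zeroEntry-unique (prependRow b (zeroEntry B' i j)) (prependRow b B') (suc i) j (zeroEntry-at B' i j) same
  where
  same : ∀ r c → (r ≡ suc i → c ≡ j → ⊥) → prependRow b (zeroEntry B' i j) r c ≡ prependRow b B' r c
  same zero    c ne = refl
  same (suc r) c ne = zeroEntry-elsewhere B' i j r c (λ r≡i c≡j → ne (cong suc r≡i) c≡j)

module _ {m n p q : ℕ} (A' : Matrix m n) (a : Fin m → ℤ) (b : Fin q → ℤ) (B' : Matrix p q)
  {i : Fin (m ℕ.+ p)} {j : Fin (n ℕ.+ q)} where

  zeroEntry-twoSumˡ : ∀ {i′ j′} → splitAt m i ≡ inj₁ i′ → splitAt n j ≡ inj₁ j′ →
    ∀ r c → zeroEntry (twoSum A' a b B') i j r c ≡ twoSum (zeroEntry A' i′ j′) a b B' r c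
  zeroEntry-twoSumˡ {i′} {j′} i≡ j≡ = zeroEntry-unique (twoSum (zeroEntry A' i′ j′) a b B') (twoSum A' a b B') i j
    (trans (twoSum-view (zeroEntry A' i′ j′) a b B' i j)
           (trans (cong₂ (blockEntry (zeroEntry A' i′ j′) a b B') i≡ j≡) (zeroEntry-at A' i′ j′)))
    (λ r c ne → trans (twoSum-view (zeroEntry A' i′ j′) a b B' r c)
                      (trans (same r c ne (splitAt m r) (splitAt n c) refl refl) (sym (twoSum-view A' a b B' r c))))
    where
    same : ∀ r c → (r ≡ i → c ≡ j → ⊥) → ∀ w w′ → splitAt m r ≡ w → splitAt n c ≡ w′ →
      blockEntry (zeroEntry A' i′ j′) a b B' w w′ ≡ blockEntry A' a b B' w w′
    same r c ne (inj₁ r′) (inj₁ c′) r≡ c≡ = zeroEntry-elsewhere A' i′ j′ r′ c′ (λ r′≡i′ c′≡j′ → ne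
      (trans (sym (splitAt⁻¹-↑ˡ r≡)) (trans (cong (_↑ˡ p) r′≡i′) (splitAt⁻¹-↑ˡ i≡)))
      (trans (sym (splitAt⁻¹-↑ˡ c≡)) (trans (cong (_↑ˡ q) c′≡j′) (splitAt⁻¹-↑ˡ j≡))))
    same r c ne (inj₁ _) (inj₂ _) _ _ = refl
    same r c ne (inj₂ _) (inj₁ _) _ _ = refl
    same r c ne (inj₂ _) (inj₂ _) _ _ = refl

  zeroEntry-twoSumʳ : ∀ {i′ j′} → splitAt m i ≡ inj₂ i′ → splitAt n j ≡ inj₂ j′ →
    ∀ r c → zeroEntry (twoSum A' a b B') i j r c ≡ twoSum A' a b (zeroEntry B' i′ j′) r c
  zeroEntry-twoSumʳ {i′} {j′} i≡ j≡ = zeroEntry-unique (twoSum A' a b (zeroEntry B' i′ j′)) (twoSum A' a b B') i j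
    (trans (twoSum-view A' a b (zeroEntry B' i′ j′) i j)
           (trans (cong₂ (blockEntry A' a b (zeroEntry B' i′ j′)) i≡ j≡) (zeroEntry-at B' i′ j′)))
    (λ r c ne → trans (twoSum-view A' a b (zeroEntry B' i′ j′) r c)
                      (trans (same r c ne (splitAt m r) (splitAt n c) refl refl) (sym (twoSum-view A' a b B' r c))))
    where
    same : ∀ r c → (r ≡ i → c ≡ j → ⊥) → ∀ w w′ → splitAt m r ≡ w → splitAt n c ≡ w′ →
      blockEntry A' a b (zeroEntry B' i′ j′) w w′ ≡ blockEntry A' a b B' w w′
    same r c ne (inj₂ r′) (inj₂ c′) r≡ c≡ = zeroEntry-elsewhere B' i′ j′ r′ c′ (λ r′≡i′ c′≡j′ → ne
      (trans (sym (splitAt⁻¹-↑ʳ r≡)) (trans (cong (m ↑ʳ_) r′≡i′) (splitAt⁻¹-↑ʳ i≡)))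
      (trans (sym (splitAt⁻¹-↑ʳ c≡)) (trans (cong (n ↑ʳ_) c′≡j′) (splitAt⁻¹-↑ʳ j≡))))
    same r c ne (inj₁ _) (inj₁ _) _ _ = refl
    same r c ne (inj₁ _) (inj₂ _) _ _ = refl
    same r c ne (inj₂ _) (inj₁ _) _ _ = refl

  -- Zeroing a ±1 entry of A': the result is the 2-sum of [A'' a] and
  -- [b ; B'], where A'' is A' with the entry zeroed; [A'' a] is TU because
  -- [A' a] is SU.
  zero-in-A' : SU (appendCol A' a) → SU (prependRow b B') → ∀ {i′ j′} →
    splitAt m i ≡ inj₁ i′ → splitAt n j ≡ inj₁ j′ → IsUnit (twoSum A' a b B' i j) → TU (zeroEntry (twoSum A' a b B') i j)
  zero-in-A' (_ , suA) (tuB , _) {i′} {j′} i≡ j≡ unit =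
    TU-resp (λ r c → sym (zeroEntry-twoSumˡ i≡ j≡ r c))
            (TwoSumTU.twoSum-TU (zeroEntry A' i′ j′) a b B' (TU-resp (zeroEntry-appendCol A' a i′ j′) (suA i′ (j′ ↑ˡ 1) unit′)) tuB)
    where
    entry : appendCol A' a i′ (j′ ↑ˡ 1) ≡ twoSum A' a b B' i j
    entry = trans (trans (appendCol-view A' a i′ (j′ ↑ˡ 1)) (cong (borderEntry A' a i′) (splitAt-↑ˡ n j′ 1)))
                  (sym (trans (twoSum-view A' a b B' i j) (cong₂ (blockEntry A' a b B') i≡ j≡)))
    unit′ : IsUnit (appendCol A' a i′ (j′ ↑ˡ 1))
    unit′ = subst IsUnit (sym entry) unit

  zero-in-B' : SU (appendCol A' a) → SU (prependRow b B') → ∀ {i′ j′} →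
    splitAt m i ≡ inj₂ i′ → splitAt n j ≡ inj₂ j′ → IsUnit (twoSum A' a b B' i j) → TU (zeroEntry (twoSum A' a b B') i j)
  zero-in-B' (tuA , _) (_ , suB) {i′} {j′} i≡ j≡ unit =
    TU-resp (λ r c → sym (zeroEntry-twoSumʳ i≡ j≡ r c))
            (TwoSumTU.twoSum-TU A' a b (zeroEntry B' i′ j′) tuA (TU-resp (zeroEntry-prependRow b B' i′ j′) (suB (suc i′) j′ unit′)))
    where
    unit′ : IsUnit (B' i′ j′)
    unit′ = subst IsUnit (trans (twoSum-view A' a b B' i j) (cong₂ (blockEntry A' a b B') i≡ j≡)) unit

-- Square submatrices avoiding row i or column j are
-- submatrices of the 2-sum.  Otherwise move row i to the top; the first row
-- of the submatrix S of Z is then split (det is additive in the first row)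
-- into a row of [A'| 0] and the row [0 | a_i₀ b̃] where b̃ is b with b_j₀
-- zeroed.  Both pieces are block determinants; in the one delicate size
-- configuration their sum is controlled by `corner-combination`, using that
-- [A' a] with a_i₀ zeroed and [b ; B'] with b_j₀ zeroed are TU.

unit⇒zu : ∀ {x} → IsUnit x → ZeroOrUnit x
unit⇒zu (inj₁ e) = inj₂ (inj₁ e)
unit⇒zu (inj₂ e) = inj₂ (inj₂ e)

unit² : ∀ {x} → IsUnit x → x * x ≡ 1ℤ
unit² (inj₁ refl) = refl
unit² (inj₂ refl) = refl

abs≡1⇒unit : ∀ x → ∣ x ∣ ≡ 1 → IsUnit x
abs≡1⇒unit (ℤ.+ suc zero)       _  = inj₁ refl
abs≡1⇒unit ℤ.-[1+ zero ]        _  = inj₂ refl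
abs≡1⇒unit (ℤ.+ zero)           ()
abs≡1⇒unit (ℤ.+ suc (suc n))    ()
abs≡1⇒unit ℤ.-[1+ suc n ]       ()

unit-abs : ∀ {x} → IsUnit x → ∣ x ∣ ≡ 1
unit-abs (inj₁ refl) = refl
unit-abs (inj₂ refl) = refl

unit-factors : ∀ x y → IsUnit (x * y) → IsUnit x × IsUnit y
unit-factors x y xy-unit =
  abs≡1⇒unit x (NP.m*n≡1⇒m≡1 ∣ x ∣ ∣ y ∣ abs≡1) , abs≡1⇒unit y (NP.m*n≡1⇒n≡1 ∣ x ∣ ∣ y ∣ abs≡1)
  where abs≡1 : ∣ x ∣ ℕ.* ∣ y ∣ ≡ 1
        abs≡1 = trans (sym (abs-* x y)) (unit-abs xy-unit)

-- p q + c d lies in {0, ±1} when p, c, q, d, p + c and q − d do: if p and c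
-- are both nonzero, then p + c ∈ {0, ±1} forces c = −p and the value is p (q − d).
unit-combination : ∀ {p c q d} → ZeroOrUnit p → ZeroOrUnit c → ZeroOrUnit q → ZeroOrUnit d →
  ZeroOrUnit (p + c) → ZeroOrUnit (q - d) → ZeroOrUnit (p * q + c * d)
unit-combination {c = c} {q} {d} (inj₁ refl) hc hq hd _ _ = subst ZeroOrUnit (sym (+-identityˡ (c * d))) (zu-* hc hd)
unit-combination {p} {q = q} hp (inj₁ refl) hq hd _ _ = subst ZeroOrUnit (sym (+-identityʳ (p * q))) (zu-* hp hq)
unit-combination (inj₂ (inj₁ refl)) (inj₂ (inj₁ refl)) _ _ (inj₁ ()) _
unit-combination (inj₂ (inj₁ refl)) (inj₂ (inj₁ refl)) _ _ (inj₂ (inj₁ ())) _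
unit-combination (inj₂ (inj₁ refl)) (inj₂ (inj₁ refl)) _ _ (inj₂ (inj₂ ())) _
unit-combination {q = q} {d} (inj₂ (inj₁ refl)) (inj₂ (inj₂ refl)) _ _ _ q-d = subst ZeroOrUnit (identity q d) q-d
  where identity : ∀ q d → q - d ≡ 1ℤ * q + -1ℤ * d
        identity = solve-∀
unit-combination {q = q} {d} (inj₂ (inj₂ refl)) (inj₂ (inj₁ refl)) _ _ _ q-d = subst ZeroOrUnit (identity q d) (zu-neg q-d)
  where identity : ∀ q d → - (q - d) ≡ -1ℤ * q + 1ℤ * d
        identity = solve-∀
unit-combination (inj₂ (inj₂ refl)) (inj₂ (inj₂ refl)) _ _ (inj₁ ()) _
unit-combination (inj₂ (inj₂ refl)) (inj₂ (inj₂ refl)) _ _ (inj₂ (inj₁ ())) _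
unit-combination (inj₂ (inj₂ refl)) (inj₂ (inj₂ refl)) _ _ (inj₂ (inj₂ ())) _

-- The unzeroed submatrix has
-- determinant σ₁ P Q = σ₁ P̃ Q + σ₂ E a Q, and the zeroed one σ₁ P̃ Q + σ₂ E a Q̃.
-- If Q = 0 the latter is σ₂ E a Q̃; otherwise Q = ±1 gives P = P̃ + σ₁ σ₂ E a,
-- and unit-combination applies to p = P̃, c = σ₁ σ₂ E a, q = Q, d = Q̃.
corner-combination : ∀ σ₁ σ₂ P P̃ Q Q̃ E a → σ₁ * σ₁ ≡ 1ℤ →
  ZeroOrUnit σ₁ → ZeroOrUnit σ₂ → ZeroOrUnit P → ZeroOrUnit P̃ → ZeroOrUnit Q → ZeroOrUnit Q̃ →
  ZeroOrUnit E → ZeroOrUnit a → ZeroOrUnit (Q - Q̃) →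
  σ₁ * (P * Q) ≡ σ₁ * (P̃ * Q) + σ₂ * (E * (a * Q)) → ZeroOrUnit (σ₁ * (P̃ * Q) + σ₂ * (E * (a * Q̃)))
corner-combination σ₁ σ₂ P P̃ Q Q̃ E a σ₁² σ₁-zu σ₂-zu P-zu P̃-zu Q-zu Q̃-zu E-zu a-zu ΔQ-zu eq = byQ Q-zu
  where
  c = σ₁ * (σ₂ * (E * a))
  c-zu : ZeroOrUnit c
  c-zu = zu-* σ₁-zu (zu-* σ₂-zu (zu-* E-zu a-zu))
  byQ : ZeroOrUnit Q → ZeroOrUnit (σ₁ * (P̃ * Q) + σ₂ * (E * (a * Q̃)))
  byQ (inj₁ refl) = subst ZeroOrUnit (identity σ₁ σ₂ P̃ E a Q̃) (zu-* (zu-* σ₂-zu (zu-* E-zu a-zu)) Q̃-zu)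
    where identity : ∀ σ₁ σ₂ P̃ E a Q̃ → σ₂ * (E * a) * Q̃ ≡ σ₁ * (P̃ * 0ℤ) + σ₂ * (E * (a * Q̃))
          identity = solve-∀
  byQ (inj₂ Q-unit) = subst ZeroOrUnit value (zu-* σ₁-zu (unit-combination P̃-zu c-zu Q-zu Q̃-zu (subst ZeroOrUnit P≡ P-zu) ΔQ-zu))
    where
    open ≡-Reasoning
    Q² : Q * Q ≡ 1ℤ
    Q² = unit² Q-unit
    cancel : ∀ {A B} x → A ≡ 1ℤ → B ≡ 1ℤ → A * B * x ≡ x
    cancel x refl refl = *-identityˡ x
    P≡ : P ≡ P̃ + c
    P≡ = begin
      P                                                    ≡⟨ cancel P σ₁² Q² ⟨
      (σ₁ * σ₁) * (Q * Q) * P                              ≡⟨ pull σ₁ Q P ⟩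
      σ₁ * Q * (σ₁ * (P * Q))                              ≡⟨ cong (σ₁ * Q *_) eq ⟩
      σ₁ * Q * (σ₁ * (P̃ * Q) + σ₂ * (E * (a * Q)))          ≡⟨ spread σ₁ σ₂ Q P̃ E a ⟩
      (σ₁ * σ₁) * (Q * Q) * P̃ + (Q * Q) * c                 ≡⟨ cong₂ _+_ (cancel P̃ σ₁² Q²) (trans (cong (_* c) Q²) (*-identityˡ c)) ⟩
      P̃ + c                                                ∎
      where pull : ∀ σ₁ Q P → (σ₁ * σ₁) * (Q * Q) * P ≡ σ₁ * Q * (σ₁ * (P * Q))
            pull = solve-∀
            spread : ∀ σ₁ σ₂ Q P̃ E a → σ₁ * Q * (σ₁ * (P̃ * Q) + σ₂ * (E * (a * Q))) ≡
                                       (σ₁ * σ₁) * (Q * Q) * P̃ + (Q * Q) * (σ₁ * (σ₂ * (E * a)))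
            spread = solve-∀
    value : σ₁ * (P̃ * Q + c * Q̃) ≡ σ₁ * (P̃ * Q) + σ₂ * (E * (a * Q̃))
    value = begin
      σ₁ * (P̃ * Q + c * Q̃)                                 ≡⟨ spread σ₁ σ₂ P̃ Q E a Q̃ ⟩
      σ₁ * (P̃ * Q) + (σ₁ * σ₁) * (σ₂ * (E * (a * Q̃)))       ≡⟨ cong (λ s → σ₁ * (P̃ * Q) + s * (σ₂ * (E * (a * Q̃)))) σ₁² ⟩
      σ₁ * (P̃ * Q) + 1ℤ * (σ₂ * (E * (a * Q̃)))              ≡⟨ cong (σ₁ * (P̃ * Q) +_) (*-identityˡ _) ⟩
      σ₁ * (P̃ * Q) + σ₂ * (E * (a * Q̃))                     ∎
      where spread : ∀ σ₁ σ₂ P̃ Q E a Q̃ → σ₁ * (P̃ * Q + σ₁ * (σ₂ * (E * a)) * Q̃) ≡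
                                          σ₁ * (P̃ * Q) + (σ₁ * σ₁) * (σ₂ * (E * (a * Q̃)))
            spread = solve-∀

module ZeroInCorner {m n p q : ℕ} (A' : Matrix m n) (a : Fin m → ℤ) (b : Fin q → ℤ) (B' : Matrix p q)
  (suA : SU (appendCol A' a)) (suB : SU (prependRow b B'))
  {i : Fin (m ℕ.+ p)} {j : Fin (n ℕ.+ q)} {i₀ : Fin m} {j₀ : Fin q}
  (i≡ : splitAt m i ≡ inj₁ i₀) (j≡ : splitAt n j ≡ inj₂ j₀) (unit : IsUnit (twoSum A' a b B' i j)) where

  open TwoSumTU A' a b B' (proj₁ suA) (proj₁ suB)

  M Z : Matrix (m ℕ.+ p) (n ℕ.+ q)
  M = twoSum A' a b B'
  Z = zeroEntry M i j

  M-ij : M i j ≡ a i₀ * b j₀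
  M-ij = trans (twoSum-view A' a b B' i j) (cong₂ (blockEntry A' a b B') i≡ j≡)

  a₀-unit : IsUnit (a i₀)
  a₀-unit = proj₁ (unit-factors (a i₀) (b j₀) (subst IsUnit M-ij unit))

  b₀-unit : IsUnit (b j₀)
  b₀-unit = proj₂ (unit-factors (a i₀) (b j₀) (subst IsUnit M-ij unit))

  Ã : Matrix m (n ℕ.+ 1)
  Ã = zeroEntry (appendCol A' a) i₀ (n ↑ʳ zero)

  Ã-TU : TU Ã
  Ã-TU = proj₂ suA i₀ (n ↑ʳ zero) (subst IsUnit (sym (appendCol-join A' a i₀ (inj₂ zero))) a₀-unit)

  B̃ : Matrix (suc p) q
  B̃ = zeroEntry (prependRow b B') zero j₀

  B̃-TU : TU B̃
  B̃-TU = proj₂ suB zero j₀ b₀-unit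

  borderDet-Ã-zu : ∀ {t} (κP : Shuffle t 1 (suc t)) (rˡ : Fin (suc t) → Fin m) (cˡ : Fin t → Fin n) →
    Injective _≡_ _≡_ rˡ → Injective _≡_ _≡_ cˡ → rˡ zero ≡ i₀ →
    ZeroOrUnit (borderDet κP (λ x y → A' (rˡ x) (cˡ y)) (0ℤ ∷ (a ∘ rˡ ∘ suc)))
  borderDet-Ã-zu {t} κP rˡ cˡ rˡ-inj cˡ-inj rˡ₀ = zu-* (sign-zu κP) (subst ZeroOrUnit (det-cong (λ x y → entries x (side κP y)))
    (Ã-TU (suc t) rˡ (λ y → join n 1 (⊎map cˡ id (side κP y))) rˡ-inj
          (side-injective κP ∘ ⊎map-injective cˡ-inj id ∘ join-injective n 1)))
    where
    column≢a : ∀ (z : Fin n) → z ↑ˡ 1 ≢ n ↑ʳ (zero {0})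
    column≢a z e with trans (sym (splitAt-↑ˡ n z 1)) (trans (cong (splitAt n) e) (splitAt-↑ʳ n 1 zero))
    ... | ()
    entries : ∀ x w → Ã (rˡ x) (join n 1 (⊎map cˡ id w)) ≡ borderEntry (λ x y → A' (rˡ x) (cˡ y)) (0ℤ ∷ (a ∘ rˡ ∘ suc)) x w
    entries x (inj₁ z) = trans (zeroEntry-elsewhere (appendCol A' a) i₀ (n ↑ʳ zero) (rˡ x) (cˡ z ↑ˡ 1) (λ _ → column≢a (cˡ z)))
                               (appendCol-join A' a (rˡ x) (inj₁ (cˡ z)))
    entries zero    (inj₂ zero) = trans (cong (λ r → Ã r (n ↑ʳ zero)) rˡ₀) (zeroEntry-at (appendCol A' a) i₀ (n ↑ʳ zero))
    entries (suc x) (inj₂ zero) = trans (zeroEntry-elsewhere (appendCol A' a) i₀ (n ↑ʳ zero) (rˡ (suc x)) (n ↑ʳ zero)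
                                          (λ r≡ _ → case rˡ-inj (trans r≡ (sym rˡ₀)) of λ ()))
                                        (appendCol-join A' a (rˡ (suc x)) (inj₂ zero))

  det-B̃-zu : ∀ {u} (rʳ : Fin u → Fin p) (cʳ : Fin (suc u) → Fin q) → Injective _≡_ _≡_ rʳ → Injective _≡_ _≡_ cʳ →
    ZeroOrUnit (det (prependRow (λ y → B̃ zero (cʳ y)) (λ x y → B' (rʳ x) (cʳ y))))
  det-B̃-zu {u} rʳ cʳ rʳ-inj cʳ-inj = subst ZeroOrUnit (det-cong entries) (B̃-TU (suc u) rows cʳ rows-inj cʳ-inj)
    where
    rows : Fin (suc u) → Fin (suc p)
    rows = zero ∷ (suc ∘ rʳ)
    rows-inj : Injective _≡_ _≡_ rows
    rows-inj {zero}  {zero}  e = refl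
    rows-inj {suc x} {suc y} e = cong suc (rʳ-inj (suc-injective e))
    entries : ∀ x y → submatrix B̃ rows cʳ x y ≡ prependRow (λ y → B̃ zero (cʳ y)) (λ x y → B' (rʳ x) (cʳ y)) x y
    entries zero    y = refl
    entries (suc x) y = zeroEntry-elsewhere (prependRow b B') zero j₀ (suc (rʳ x)) (cʳ y) (λ ())

  -- The blocks of a square submatrix through row i (placed first): its rows
  -- are i₀ followed by rA₀ (A-part) and rB₀ (B-part) interleaved by left ρ₀,
  -- its columns cA and cB interleaved by κ.
  module CornerBlocks {s₀ u t v k} (ρ₀ : Shuffle s₀ u k) (κ : Shuffle t v (suc k))
    (rA₀ : Fin s₀ → Fin m) (rB₀ : Fin u → Fin p) (cA : Fin t → Fin n) (cB : Fin v → Fin q) where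

    X₀ : Fin (suc s₀) → Fin t → ℤ
    X₀ x y = A' ((i₀ ∷ rA₀) x) (cA y)

    α₀ : Fin (suc s₀) → ℤ
    α₀ = a ∘ (i₀ ∷ rA₀)

    β β̃ : Fin v → ℤ
    β = b ∘ cB
    β̃ y = B̃ zero (cB y)

    Y : Fin u → Fin v → ℤ
    Y x y = B' (rB₀ x) (cB y)

    -- T is the submatrix of the 2-sum.  T₁ keeps only the left part of its
    -- first row; `rightTop γ` keeps the right part, changed to α₀(0) γ, and
    -- regards it as a row of the bottom part.
    rightTop : (Fin v → ℤ) → Matrix (suc k) (suc k)
    rightTop γ = block (right ρ₀) κ (dropTop X₀) (α₀ ∘ suc) β ((λ y → α₀ zero * γ y) ∷ Y)

    T T₁ : Matrix (suc k) (suc k)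
    T  = block (left ρ₀) κ X₀ α₀ β Y
    T₁ = block (left ρ₀) κ X₀ (0ℤ ∷ (α₀ ∘ suc)) β Y

    lower : Fin k → Fin (suc k) → ℤ
    lower x c = blockEntry (dropTop X₀) (α₀ ∘ suc) β Y (side ρ₀ x) (side κ c)

    T-lower : ∀ x c → T (suc x) c ≡ lower x c
    T-lower x c = blockEntry-dropTop X₀ α₀ β Y (side ρ₀ x) (side κ c)

    T₁-lower : ∀ x c → T₁ (suc x) c ≡ lower x c
    T₁-lower x c = blockEntry-dropTop X₀ (0ℤ ∷ (α₀ ∘ suc)) β Y (side ρ₀ x) (side κ c)

    rightTop-lower : ∀ γ x c → rightTop γ (suc x) c ≡ lower x c
    rightTop-lower γ x c = blockEntry-dropTopʳ (dropTop X₀) (α₀ ∘ suc) β ((λ y → α₀ zero * γ y) ∷ Y) (side ρ₀ x) (side κ c)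

    det-T-split : det T ≡ det T₁ + det (rightTop β)
    det-T-split = det-linearTop T T₁ (rightTop β)
      (λ x c → trans (T-lower x c) (sym (T₁-lower x c)))
      (λ x c → trans (T-lower x c) (sym (rightTop-lower β x c)))
      (λ c → top (side κ c))
      where top : ∀ w → blockEntry X₀ α₀ β Y (inj₁ zero) w ≡
                        blockEntry X₀ (0ℤ ∷ (α₀ ∘ suc)) β Y (inj₁ zero) w
                        + blockEntry (dropTop X₀) (α₀ ∘ suc) β ((λ y → α₀ zero * β y) ∷ Y) (inj₂ zero) w
            top (inj₁ y) = sym (+-identityʳ (X₀ zero y))
            top (inj₂ y) = sym (+-identityˡ (α₀ zero * β y))

    det-rightTop-split : ∀ {γ} γ₁ γ₂ → (∀ y → γ y ≡ γ₁ y + γ₂ y) →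
      det (rightTop γ) ≡ det (rightTop γ₁) + det (rightTop γ₂)
    det-rightTop-split {γ} γ₁ γ₂ γ≡ = det-linearTop (rightTop γ) (rightTop γ₁) (rightTop γ₂)
      (λ x c → trans (rightTop-lower γ x c) (sym (rightTop-lower γ₁ x c)))
      (λ x c → trans (rightTop-lower γ x c) (sym (rightTop-lower γ₂ x c)))
      (λ c → top (side κ c))
      where top : ∀ w → blockEntry (dropTop X₀) (α₀ ∘ suc) β ((λ y → α₀ zero * γ y) ∷ Y) (inj₂ zero) w ≡
                        blockEntry (dropTop X₀) (α₀ ∘ suc) β ((λ y → α₀ zero * γ₁ y) ∷ Y) (inj₂ zero) w
                        + blockEntry (dropTop X₀) (α₀ ∘ suc) β ((λ y → α₀ zero * γ₂ y) ∷ Y) (inj₂ zero) w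
            top (inj₁ y) = refl
            top (inj₂ y) = trans (cong (α₀ zero *_) (γ≡ y)) (*-distribˡ-+ (α₀ zero) (γ₁ y) (γ₂ y))

    module AtColumn (cB-inj : Injective _≡_ _≡_ cB) (yb : Fin v) (cB-yb : cB yb ≡ j₀) where

      β̃-yb : β̃ yb ≡ 0ℤ
      β̃-yb = trans (cong (B̃ zero) cB-yb) (zeroEntry-at (prependRow b B') zero j₀)

      β̃-elsewhere : ∀ y → y ≢ yb → β̃ y ≡ β y
      β̃-elsewhere y y≢yb = zeroEntry-elsewhere (prependRow b B') zero j₀ zero (cB y) (λ _ e → y≢yb (cB-inj (trans e (sym cB-yb))))

      Δ : Fin v → ℤ
      Δ y = β̃ y - β y

      Δ-elsewhere : ∀ y → y ≢ yb → Δ y ≡ 0ℤ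
      Δ-elsewhere y y≢yb = trans (cong (_- β y) (β̃-elsewhere y y≢yb)) (+-inverseʳ (β y))

      Δ-yb : Δ yb ≡ - b j₀
      Δ-yb = trans (cong₂ _-_ β̃-yb (cong b cB-yb)) (+-identityˡ (- b j₀))

      -- Changing the first row from α₀(0) β to α₀(0) β̃ adds the determinant of
      -- rightTop Δ, whose first row has a single nonzero entry.
      det-rightTop-change : det (rightTop β̃) ≡ det (rightTop β) + det (rightTop Δ)
      det-rightTop-change = det-rightTop-split β Δ (λ y → split (β̃ y) (β y))
        where split : ∀ x y → x ≡ y + (x - y)
              split = solve-∀

      det-rightTop-Δ : det (rightTop Δ) ≡ cofactorTerm (rightTop Δ) (posʳ κ yb)
      det-rightTop-Δ = det-singleTop (rightTop Δ) (posʳ κ yb) (λ c c≢ → top c c≢ (side κ c) refl)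
        where
        top : ∀ c → c ≢ posʳ κ yb → ∀ w → side κ c ≡ w →
              blockEntry (dropTop X₀) (α₀ ∘ suc) β ((λ y → α₀ zero * Δ y) ∷ Y) (inj₂ zero) w ≡ 0ℤ
        top c c≢ (inj₁ y) _  = refl
        top c c≢ (inj₂ y) c≡ = trans (cong (α₀ zero *_) (Δ-elsewhere y y≢yb)) (*-zeroʳ (α₀ zero))
          where y≢yb : y ≢ yb
                y≢yb refl = c≢ (side-injective κ (trans c≡ (sym (side-posʳ κ yb))))

  -- The delicate configuration: as many A-rows besides i₀ as A-columns.
  -- Then T and T₁ are border blocks, rightTop _ are square blocks, and
  -- corner-combination applies.
  corner-square : ∀ {s₀ u t v k} → s₀ ≡ t → v ≡ suc u →
    (ρ₀ : Shuffle s₀ u k) (κ : Shuffle t v (suc k)) (rA₀ : Fin s₀ → Fin m) (rB₀ : Fin u → Fin p)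
    (cA : Fin t → Fin n) (cB : Fin v → Fin q) →
    Injective _≡_ _≡_ (i₀ ∷ rA₀) → Injective _≡_ _≡_ rB₀ → Injective _≡_ _≡_ cA → Injective _≡_ _≡_ cB →
    (yb : Fin v) → cB yb ≡ j₀ →
    let open CornerBlocks ρ₀ κ rA₀ rB₀ cA cB in ZeroOrUnit (det T₁ + det (rightTop β̃))
  corner-square {s₀} refl refl ρ₀ κ rA₀ rB₀ cA cB rA-inj rB-inj cA-inj cB-inj yb cB-yb =
    subst ZeroOrUnit (sym (cong₂ _+_ det-T₁ (det-rightTop β̃)))
      (corner-combination σ₁ σ₂ P P̃ Q Q̃ E (a i₀) σ₁² (zu-* (sign-zu ρ₀) (sign-zu κ)) (zu-* (sign-zu (right ρ₀)) (sign-zu κ))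
         (borderDet-zu (lastRight s₀) (i₀ ∷ rA₀) cA rA-inj cA-inj)
         (borderDet-Ã-zu (lastRight s₀) (i₀ ∷ rA₀) cA rA-inj cA-inj refl)
         (det-prependRow-zu rB₀ cB rB-inj cB-inj)
         (det-B̃-zu rB₀ cB rB-inj cB-inj)
         (det-A'-zu rA₀ cA (suc-injective ∘ rA-inj) cA-inj)
         (unit⇒zu a₀-unit) ΔQ-zu det-T-expanded)
    where
    open CornerBlocks ρ₀ κ rA₀ rB₀ cA cB
    open AtColumn cB-inj yb cB-yb
    σ₁ σ₂ P P̃ Q Q̃ E : ℤ
    σ₁ = shuffleSign ρ₀ * shuffleSign κ
    σ₂ = shuffleSign (right ρ₀) * shuffleSign κ
    P  = borderDet (lastRight s₀) X₀ α₀
    P̃  = borderDet (lastRight s₀) X₀ (0ℤ ∷ (α₀ ∘ suc))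
    Q  = det (prependRow β Y)
    Q̃  = det (prependRow β̃ Y)
    E  = det (dropTop X₀)
    σ₁² : σ₁ * σ₁ ≡ 1ℤ
    σ₁² = trans (regroup (shuffleSign ρ₀) (shuffleSign κ)) (cong₂ _*_ (sign²≡1 ρ₀) (sign²≡1 κ))
      where regroup : ∀ x y → (x * y) * (x * y) ≡ (x * x) * (y * y)
            regroup = solve-∀
    det-T₁ : det T₁ ≡ σ₁ * (P̃ * Q)
    det-T₁ = det-block-border (left ρ₀) κ (lastRight s₀) X₀ (0ℤ ∷ (α₀ ∘ suc)) β Y
    det-rightTop : ∀ γ → det (rightTop γ) ≡ σ₂ * (E * (a i₀ * det (prependRow γ Y)))
    det-rightTop γ =
      trans (det-block-square (right ρ₀) κ (dropTop X₀) (α₀ ∘ suc) β ((λ y → α₀ zero * γ y) ∷ Y))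
            (cong (λ D → σ₂ * (E * D)) (det-scaleTop ((λ y → α₀ zero * γ y) ∷ Y) (prependRow γ Y) (a i₀) (λ _ → refl) (λ _ _ → refl)))
    det-T-expanded : σ₁ * (P * Q) ≡ σ₁ * (P̃ * Q) + σ₂ * (E * (a i₀ * Q))
    det-T-expanded = trans (sym (det-block-border (left ρ₀) κ (lastRight s₀) X₀ α₀ β Y))
                           (trans det-T-split (cong₂ _+_ det-T₁ (det-rightTop β)))
    -- Q̃ − Q is the determinant of [Δ ; Y], a single term ± b_j₀ · (minor of B').
    ΔQ-zu : ZeroOrUnit (Q - Q̃)
    ΔQ-zu = subst ZeroOrUnit (sym difference) (zu-neg (subst ZeroOrUnit (sym (det-singleTop (prependRow Δ Y) yb Δ-elsewhere))
              (zu-* (alt-zu (toℕ yb))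
                    (zu-* (subst ZeroOrUnit (sym Δ-yb) (zu-neg (unit⇒zu b₀-unit)))
                          (det-B'-zu rB₀ (cB ∘ punchIn yb) rB-inj (punchIn-injective yb _ _ ∘ cB-inj))))))
      where
      split : ∀ x y → x ≡ y + (x - y)
      split = solve-∀
      Q̃≡ : Q̃ ≡ Q + det (prependRow Δ Y)
      Q̃≡ = det-linearTop (prependRow β̃ Y) (prependRow β Y) (prependRow Δ Y) (λ _ _ → refl) (λ _ _ → refl)
             (λ y → split (β̃ y) (β y))
      cancel : ∀ x d → x - (x + d) ≡ - d
      cancel = solve-∀
      difference : Q - Q̃ ≡ - det (prependRow Δ Y)
      difference = trans (cong (λ x → Q - x) Q̃≡) (cancel Q (det (prependRow Δ Y)))

  through-corner : ∀ {k} (r₀ : Fin k → Fin (m ℕ.+ p)) (c : Fin (suc k) → Fin (n ℕ.+ q)) →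
    Injective _≡_ _≡_ (i ∷ r₀) → Injective _≡_ _≡_ c → ∀ y₀ → c y₀ ≡ j → ZeroOrUnit (det (submatrix Z (i ∷ r₀) c))
  through-corner {k} r₀ c r-inj c-inj y₀ c-y₀ = byColumn (side κ y₀) refl
    where
    R₀ = splitIndex k r₀
    C  = splitIndex (suc k) c
    open IndexSplit R₀ using () renaming (s to s₀; u to u; ρ to ρ₀; pickˡ to rA₀; pickʳ to rB₀)
    open IndexSplit C using () renaming (s to t; u to v; ρ to κ; pickˡ to cA; pickʳ to cB)

    R : IndexSplit m p (suc k) (i ∷ r₀)
    R = record { s = suc s₀ ; u = u ; ρ = left ρ₀ ; pickˡ = i₀ ∷ rA₀ ; pickʳ = rB₀ ; splits = λ where
      zero    → i≡
      (suc x) → trans (IndexSplit.splits R₀ x) (sym (map-map {f = suc} {g = id} {f′ = i₀ ∷ rA₀} {g′ = rB₀} (side ρ₀ x))) }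

    rA-inj = pickˡ-injective R r-inj
    rB-inj = pickʳ-injective R r-inj
    cA-inj = pickˡ-injective C c-inj
    cB-inj = pickʳ-injective C c-inj
    r₀-inj : Injective _≡_ _≡_ r₀
    r₀-inj = suc-injective ∘ r-inj

    TZ : Matrix (suc k) (suc k)
    TZ = submatrix Z (i ∷ r₀) c

    column-split : ∀ c′ → c c′ ≡ j → ⊎map cA cB (side κ c′) ≡ inj₂ j₀
    column-split c′ e = trans (sym (IndexSplit.splits C c′)) (trans (cong (splitAt n) e) j≡)

    atColumn : ∀ yb → side κ y₀ ≡ inj₂ yb → cB yb ≡ j₀ → ZeroOrUnit (det TZ)
    byColumn : ∀ w → side κ y₀ ≡ w → ZeroOrUnit (det TZ)
    byColumn (inj₁ y)  e = case trans (sym (cong (⊎map cA cB) e)) (column-split y₀ c-y₀) of λ ()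
    byColumn (inj₂ yb) e = atColumn yb e (inj₂-injective (trans (sym (cong (⊎map cA cB) e)) (column-split y₀ c-y₀)))

    atColumn yb side-y₀ cB-yb = bySize
      where
      open CornerBlocks ρ₀ κ rA₀ rB₀ cA cB
      open AtColumn cB-inj yb cB-yb

      T-sub : ∀ x y → submatrix M (i ∷ r₀) c x y ≡ T x y
      T-sub = twoSum-submatrix A' a b B' R C

      TZ-lower : ∀ x c′ → TZ (suc x) c′ ≡ lower x c′
      TZ-lower x c′ = trans (zeroEntry-elsewhere M i j (r₀ x) (c c′) (λ r≡i _ → case r-inj {suc x} {zero} r≡i of λ ()))
                            (trans (T-sub (suc x) c′) (T-lower x c′))

      TZ-top : ∀ c′ → TZ zero c′ ≡ T₁ zero c′ + rightTop β̃ zero c′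
      TZ-top c′ = byItem (side κ c′) refl
        where
        untouched : c c′ ≢ j → TZ zero c′ ≡ T zero c′
        untouched c≢j = trans (zeroEntry-elsewhere M i j i (c c′) (λ _ → c≢j)) (T-sub zero c′)
        byItem : ∀ w → side κ c′ ≡ w → TZ zero c′ ≡ blockEntry X₀ (0ℤ ∷ (α₀ ∘ suc)) β Y (inj₁ zero) w
                          + blockEntry (dropTop X₀) (α₀ ∘ suc) β ((λ y → α₀ zero * β̃ y) ∷ Y) (inj₂ zero) w
        byItem (inj₁ y) e = trans (untouched (λ c≡j → case trans (sym (cong (⊎map cA cB) e)) (column-split c′ c≡j) of λ ()))
                                  (trans (cong (blockEntry X₀ α₀ β Y (inj₁ zero)) e) (sym (+-identityʳ (X₀ zero y))))
        byItem (inj₂ y) e with y ≟ yb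
        ... | yes refl = begin
          Z i (c c′)                  ≡⟨ cong (Z i) (trans (cong c (side-injective κ (trans e (sym side-y₀)))) c-y₀) ⟩
          Z i j                       ≡⟨ zeroEntry-at M i j ⟩
          0ℤ                          ≡⟨ sym (*-zeroʳ (α₀ zero)) ⟩
          α₀ zero * 0ℤ                ≡⟨ cong (α₀ zero *_) β̃-yb ⟨
          α₀ zero * β̃ y               ≡⟨ +-identityˡ (α₀ zero * β̃ y) ⟨
          0ℤ + α₀ zero * β̃ y          ∎
          where open ≡-Reasoning
        ... | no y≢yb = begin
          TZ zero c′                  ≡⟨ untouched (λ c≡j → y≢yb (cB-inj (trans (inj₂-injective
                                             (trans (sym (cong (⊎map cA cB) e)) (column-split c′ c≡j))) (sym cB-yb)))) ⟩
          T zero c′                   ≡⟨ cong (blockEntry X₀ α₀ β Y (inj₁ zero)) e ⟩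
          α₀ zero * β y               ≡⟨ cong (α₀ zero *_) (β̃-elsewhere y y≢yb) ⟨
          α₀ zero * β̃ y               ≡⟨ +-identityˡ (α₀ zero * β̃ y) ⟨
          0ℤ + α₀ zero * β̃ y          ∎
          where open ≡-Reasoning

      det-TZ : det TZ ≡ det T₁ + det (rightTop β̃)
      det-TZ = det-linearTop TZ T₁ (rightTop β̃) (λ x c′ → trans (TZ-lower x c′) (sym (T₁-lower x c′)))
                 (λ x c′ → trans (TZ-lower x c′) (sym (rightTop-lower β̃ x c′))) TZ-top

      det-T-zu : ZeroOrUnit (det T)
      det-T-zu = subst ZeroOrUnit (det-cong T-sub) (twoSum-TU (suc k) (i ∷ r₀) c r-inj c-inj)

      -- det (rightTop Δ) = ± a_i₀ b_j₀ · (a minor of the 2-sum).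
      det-rightTopΔ-zu : ZeroOrUnit (det (rightTop Δ))
      det-rightTopΔ-zu = subst ZeroOrUnit (sym det-rightTop-Δ)
        (zu-* (alt-zu (toℕ yR)) (zu-* entry-zu
          (subst ZeroOrUnit (det-cong minor-sub)
                 (twoSum-TU k r₀ (c ∘ punchIn yR) r₀-inj (punchIn-injective yR _ _ ∘ c-inj)))))
        where
        yR = posʳ κ yb
        entry-zu : ZeroOrUnit (rightTop Δ zero yR)
        entry-zu = subst ZeroOrUnit (cong (blockEntry (dropTop X₀) (α₀ ∘ suc) β ((λ y → α₀ zero * Δ y) ∷ Y) (inj₂ zero))
                                          (sym (side-posʳ κ yb)))
                     (zu-* (unit⇒zu a₀-unit) (subst ZeroOrUnit (sym Δ-yb) (zu-neg (unit⇒zu b₀-unit))))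
        minor-sub : ∀ x c′ → submatrix M r₀ (c ∘ punchIn yR) x c′ ≡ minor (rightTop Δ) yR x c′
        minor-sub x c′ = trans (T-sub (suc x) (punchIn yR c′))
                               (trans (T-lower x (punchIn yR c′)) (sym (rightTop-lower Δ x (punchIn yR c′))))

      bySize : ZeroOrUnit (det TZ)
      bySize with NP.<-cmp (suc s₀) t
      ... | tri< 1+s₀<t _ _ = subst ZeroOrUnit (sym (trans det-TZ (cong₂ _+_
              (det-block-short (left ρ₀) κ X₀ (0ℤ ∷ (α₀ ∘ suc)) β Y 1+s₀<t)
              (det-block-short (right ρ₀) κ (dropTop X₀) (α₀ ∘ suc) β ((λ y → α₀ zero * β̃ y) ∷ Y) (NP.<-trans (NP.n<1+n s₀) 1+s₀<t)))))
              zu-zero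
      ... | tri≈ _ 1+s₀≡t _ = subst ZeroOrUnit (sym det-TZ≡det-T) det-T-zu
        where
        s₀<t = NP.≤-reflexive 1+s₀≡t
        det-TZ≡det-T : det TZ ≡ det T
        det-TZ≡det-T = trans det-TZ (trans (cong (det T₁ +_)
          (trans (det-block-short (right ρ₀) κ (dropTop X₀) (α₀ ∘ suc) β ((λ y → α₀ zero * β̃ y) ∷ Y) s₀<t)
                 (sym (det-block-short (right ρ₀) κ (dropTop X₀) (α₀ ∘ suc) β ((λ y → α₀ zero * β y) ∷ Y) s₀<t))))
          (sym det-T-split))
      ... | tri> _ _ t<1+s₀ with NP.m≤n⇒m<n∨m≡n (NP.≤-pred t<1+s₀)
      ...   | inj₁ t<s₀ = subst ZeroOrUnit (sym det-TZ≡) det-rightTopΔ-zu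
        where
        det-T₁≡0 : det T₁ ≡ 0ℤ
        det-T₁≡0 = det-block-tall (left ρ₀) κ X₀ (0ℤ ∷ (α₀ ∘ suc)) β Y (s≤s t<s₀)
        det-rightTop-β≡0 : det (rightTop β) ≡ 0ℤ
        det-rightTop-β≡0 = trans (sym (+-identityˡ _)) (trans (cong (_+ det (rightTop β)) (sym det-T₁≡0))
                             (trans (sym det-T-split) (det-block-tall (left ρ₀) κ X₀ α₀ β Y (s≤s t<s₀))))
        det-TZ≡ : det TZ ≡ det (rightTop Δ)
        det-TZ≡ = trans det-TZ (trans (cong₂ _+_ det-T₁≡0 (trans det-rightTop-change (cong (_+ det (rightTop Δ)) det-rightTop-β≡0)))
                    (trans (+-identityˡ _) (+-identityˡ _)))
      ...   | inj₂ t≡s₀ = subst ZeroOrUnit (sym det-TZ)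
                (corner-square (sym t≡s₀) v≡1+u ρ₀ κ rA₀ rB₀ cA cB rA-inj rB-inj cA-inj cB-inj yb cB-yb)
        where
        v≡1+u : v ≡ suc u
        v≡1+u = NP.+-cancelˡ-≡ s₀ v (suc u) (trans (cong (ℕ._+ v) (sym t≡s₀)) (trans (shuffle-size κ)
                  (trans (cong suc (sym (shuffle-size ρ₀))) (sym (NP.+-suc s₀ u)))))

  avoiding : ∀ {k} (r : Fin k → Fin (m ℕ.+ p)) (c : Fin k → Fin (n ℕ.+ q)) → Injective _≡_ _≡_ r → Injective _≡_ _≡_ c →
    (∀ x y → r x ≡ i → c y ≡ j → ⊥) → ZeroOrUnit (det (submatrix Z r c))
  avoiding {k} r c r-inj c-inj ne =
    subst ZeroOrUnit (det-cong (λ x y → sym (zeroEntry-elsewhere M i j (r x) (c y) (ne x y)))) (twoSum-TU k r c r-inj c-inj)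

  through : ∀ {k} (r : Fin k → Fin (m ℕ.+ p)) (c : Fin k → Fin (n ℕ.+ q)) → Injective _≡_ _≡_ r → Injective _≡_ _≡_ c →
    ∀ x₀ → r x₀ ≡ i → ∀ y₀ → c y₀ ≡ j → ZeroOrUnit (det (submatrix Z r c))
  through {suc k} r c r-inj c-inj x₀ r-x₀ y₀ c-y₀ =
    subst ZeroOrUnit (sym det≡) (zu-* (alt-zu (toℕ x₀)) (through-corner (r ∘ punchIn x₀) c rows-inj c-inj y₀ c-y₀))
    where
    rows-inj : Injective _≡_ _≡_ (i ∷ (r ∘ punchIn x₀))
    rows-inj {zero}  {zero}  _ = refl
    rows-inj {zero}  {suc y} e = ⊥-elim (punchInᵢ≢i x₀ y (sym (r-inj (trans r-x₀ e))))
    rows-inj {suc x} {zero}  e = ⊥-elim (punchInᵢ≢i x₀ x (sym (r-inj (trans r-x₀ (sym e)))))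
    rows-inj {suc x} {suc y} e = cong suc (punchIn-injective x₀ x y (r-inj e))
    moved : ∀ x y → moveToTop x₀ (submatrix Z r c) x y ≡ submatrix Z (i ∷ (r ∘ punchIn x₀)) c x y
    moved zero    y = cong (λ z → Z z (c y)) r-x₀
    moved (suc x) y = refl
    det≡ : det (submatrix Z r c) ≡ alt (toℕ x₀) * det (submatrix Z (i ∷ (r ∘ punchIn x₀)) c)
    det≡ = begin
      det (submatrix Z r c)                                           ≡⟨ *-identityˡ _ ⟨
      1ℤ * det (submatrix Z r c)                                      ≡⟨ cong (_* det (submatrix Z r c)) (alt²≡1 (toℕ x₀)) ⟨
      alt (toℕ x₀) * alt (toℕ x₀) * det (submatrix Z r c)             ≡⟨ *-assoc (alt (toℕ x₀)) _ _ ⟩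
      alt (toℕ x₀) * (alt (toℕ x₀) * det (submatrix Z r c))           ≡⟨ cong (alt (toℕ x₀) *_) (det-moveToTop x₀ (submatrix Z r c)) ⟨
      alt (toℕ x₀) * det (moveToTop x₀ (submatrix Z r c))             ≡⟨ cong (alt (toℕ x₀) *_) (det-cong moved) ⟩
      alt (toℕ x₀) * det (submatrix Z (i ∷ (r ∘ punchIn x₀)) c)       ∎
      where open ≡-Reasoning

  zeroEntry-TU : TU Z
  zeroEntry-TU k r c r-inj c-inj with any? (λ x → r x ≟ i) | any? (λ y → c y ≟ j)
  ... | no no-i           | _                 = avoiding r c r-inj c-inj (λ x _ r≡i _ → no-i (x , r≡i))
  ... | yes _             | no no-j           = avoiding r c r-inj c-inj (λ _ y _ c≡j → no-j (y , c≡j))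
  ... | yes (x₀ , r-x₀)   | yes (y₀ , c-y₀)   = through r c r-inj c-inj x₀ r-x₀ y₀ c-y₀

zero-not-unit : ¬ IsUnit 0ℤ
zero-not-unit (inj₁ ())
zero-not-unit (inj₂ ())

lemma5 : ∀ {m n p q : ℕ} (A' : Matrix m n) (a : Fin m → ℤ) (b : Fin q → ℤ) (B' : Matrix p q) →
    SU (appendCol A' a) → SU (prependRow b B') → SU (twoSum A' a b B')
lemma5 {m} {n} A' a b B' suA suB = TwoSumTU.twoSum-TU A' a b B' (proj₁ suA) (proj₁ suB) , zeroing
  where
  zeroing : ∀ i j → IsUnit (twoSum A' a b B' i j) → TU (zeroEntry (twoSum A' a b B') i j)
  zeroing i j unit = byBlock (splitAt m i) refl (splitAt n j) refl
    where
    byBlock : ∀ w → splitAt m i ≡ w → ∀ w′ → splitAt n j ≡ w′ → TU (zeroEntry (twoSum A' a b B') i j)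
    byBlock (inj₁ _) i≡ (inj₁ _) j≡ = zero-in-A' A' a b B' suA suB i≡ j≡ unit
    byBlock (inj₂ _) i≡ (inj₂ _) j≡ = zero-in-B' A' a b B' suA suB i≡ j≡ unit
    byBlock (inj₁ _) i≡ (inj₂ _) j≡ = ZeroInCorner.zeroEntry-TU A' a b B' suA suB i≡ j≡ unit
    byBlock (inj₂ _) i≡ (inj₁ _) j≡ =
      ⊥-elim (zero-not-unit (subst IsUnit (trans (twoSum-view A' a b B' i j) (cong₂ (blockEntry A' a b B') i≡ j≡)) unit))
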